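{- For positive integers $p,q$ with $p \geq 4q$, \[ a_{p,q,2} = \begin{cases} \frac{1}{24}(q^4+6q^3+20q^2+36q+24) & \text{if } q \text{ is even},\\ \frac{1}{24}(q^4+6q^3+20q^2+30q+15) & \text{if } q \text{ is odd}.\end{cases} \]
   Context: Let $[p]_q^r$ be the set of sets of $r$ pairwise disjoint $q$-subsets of $[p]$. For $S,T,S',T'\in[p]_q^r$, $(S,T)\sim(S',T')$ iff there is a permutation $\sigma$ of $[p]$ mapping each member of $S$ onto a member of $S'$ and each member of $T$ onto a member of $T'$. $a_{p,q,r}$ denotes the number of equivalence classes of $\sim$ on $[p]_q^r\times[p]_q^r$. -}

module Defs where

open import Data.Nat using (ℕ; zero; suc; _+_; _*_; _^_)
open import Data.Fin using (Fin)
open import Data.Fin.Subset using (Subset; _∩_; ⊥; ∣_∣)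
open import Data.Fin.Permutation using (Permutation′; _⟨$⟩ˡ_)
open import Data.Vec using (tabulate; lookup)
open import Data.List using (List; length)
open import Data.List.Membership.Propositional using (_∈_)
open import Data.List.Relation.Unary.All using (All)
open import Data.List.Relation.Unary.AllPairs using (AllPairs)
open import Data.List.Relation.Unary.Unique.Propositional using (Unique)
open import Data.Product using (Σ; _×_)
open import Function.Bundles using (_⇔_)
open import Function.Definitions using (Surjective)
open import Relation.Binary.PropositionalEquality using (_≡_)

Disjoint : ∀ {p} → Subset p → Subset p → Set
Disjoint A B = A ∩ B ≡ ⊥

-- An element of [p]_q^r: a set of r pairwise disjoint q-subsets of [p],
-- represented by a duplicate-free list of its members (the same set may be
-- represented by several orderings; the relation ∼ below identifies them).
record Family (p q r : ℕ) : Set where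
  constructor family
  field
    members  : List (Subset p)
    unique   : Unique members
    size     : length members ≡ r
    qsubsets : All (λ A → ∣ A ∣ ≡ q) members
    disjoint : AllPairs Disjoint members
open Family public

image : ∀ {p} → Permutation′ p → Subset p → Subset p
image σ A = tabulate (λ j → lookup A (σ ⟨$⟩ˡ j))

MapsInto : ∀ {p q r} → Permutation′ p → Family p q r → Family p q r → Set
MapsInto σ S S' = All (λ A → image σ A ∈ members S') (members S)

_∼_ : ∀ {p q r} → Family p q r × Family p q r → Family p q r × Family p q r → Set
_∼_ {p} (S Data.Product., T) (S' Data.Product., T') =
  Σ (Permutation′ p) (λ σ → MapsInto σ S S' × MapsInto σ T T')

-- "∼ has exactly N equivalence classes on [p]_q^r × [p]_q^r":
-- there is a surjection onto Fin N whose fibres are exactly the ∼-classes.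
NumClasses : ℕ → ℕ → ℕ → ℕ → Set
NumClasses p q r N =
  Σ (Family p q r × Family p q r → Fin N) λ cls →
    Surjective _≡_ _≡_ cls × (∀ x y → (cls x ≡ cls y) ⇔ (x ∼ y))

module Submission where

-- A pair (S , T) with S = {A₁ , A₂} and T = {B₁ , B₂} determines the 2×2 matrix of intersection
-- sizes ∣Aᵢ ∩ Bⱼ∣, and reordering the members of S or of T swaps its rows or its columns. Two pairs
-- are equivalent iff their matrices agree up to these swaps: a permutation preserves intersection
-- sizes, and conversely, if the matrices agree, the colourings of [p] by membership in the four sets
-- have classes of equal sizes, so one colouring is a permutation of the other. For p ≥ 4q every
-- matrix with row and column sums at most q occurs, so a_{p,q,2} counts such matrices up to the
-- four swaps. Taking the lexicographically largest matrix of each orbit as its representative, the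
-- representatives fall into eight explicit families according to which entries tie with the
-- largest one, and summing the family sizes gives the formula.

open import Defs
open import Data.Nat using (ℕ; zero; suc; _+_; _*_; _∸_; _^_; _<_; _≤_; _≤?_; _<?_; _≟_; _≡ᵇ_; _%_; s≤s; z≤n)
open import Data.Nat.Properties using (+-0-commutativeMonoid; *-assoc; *-distribˡ-+; *-identityʳ; *-zeroʳ; +-assoc; +-cancelʳ-≡; +-cancelʳ-≤; +-cancelˡ-≡; +-cancelˡ-≤; +-comm; +-identityʳ; +-mono-<-≤; +-mono-≤; +-mono-≤-<; +-monoʳ-≤; +-monoˡ-≤; +-suc; 0≢1+n; 1+n≰n; <-irrefl; <-isStrictTotalOrder; <-trans; <-≤-trans; <⇒≤; m+[n∸m]≡n; m+n∸n≡m; m+n≤o⇒m≤o∸n; m<n⇒m<1+n; m∸[m∸n]≡n; m∸n+n≡m; m≤m+n; m≤n+m; m≤n⇒m<n∨m≡n; m≤n⇒m≤1+n; n<1+n; ≤-<-trans; ≤-isDecTotalOrder; ≤-pred; ≤-refl; ≤-reflexive; ≤-trans; ≮⇒≥; ≰⇒>)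
open import Data.Nat.DivMod using (m*n%n≡0; [m+kn]%n≡m%n)
open import Data.Nat.ListAction using (sum)
open import Data.Nat.ListAction.Properties using (sum-++)
open import Data.Nat.Tactic.RingSolver using (solve-∀)
open import Data.Bool using (Bool; true; false; _∧_; _xor_; if_then_else_)
open import Data.Bool.Properties using (∧-comm)
open import Data.Bool.ListAction using (any)
open import Data.Empty using (⊥-elim)
open import Data.Fin using (Fin; zero; suc; punchIn)
open import Data.Fin.Permutation using (Permutation′; _⟨$⟩ʳ_; _⟨$⟩ˡ_; insert; insert-punchIn; inverseˡ; inverseʳ)
import Data.Fin.Permutation as Perm
open import Data.Fin.Subset using (Subset; ∣_∣; _∩_; ⊥; inside; outside)
open import Data.Fin.Subset.Properties using (∩-comm; ∩-idem; ∣⊥∣≡0)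
open import Data.List using (List; []; _∷_; _++_; [_]; length; concatMap; upTo)
import Data.List as List
open import Data.List.Properties using (upTo-∷ʳ; concatMap-++; ++-identityʳ; length-++)
open import Data.List.Membership.Propositional using (_∈_; find; lose)
open import Data.List.Membership.Propositional.Properties using (∈-concatMap⁺; ∈-concatMap⁻; ∈-upTo⁺; ∈-upTo⁻; ∈-lookup)
open import Data.List.Membership.Setoid.Properties using (unique⇒irrelevant)
open import Data.List.Relation.Unary.All using (All; []; _∷_)
import Data.List.Relation.Unary.All as All
open import Data.List.Relation.Unary.AllPairs using (AllPairs; []; _∷_)
open import Data.List.Relation.Unary.Any using (index; here; there)
open import Data.List.Relation.Unary.Any.Properties using (lookup-index)
open import Data.List.Relation.Unary.Unique.Propositional using (Unique)
open import Data.List.Relation.Unary.Unique.Propositional.Properties using (++⁺)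
open import Data.Maybe using (Maybe; just; nothing)
import Data.Maybe.Properties as Maybe
open import Data.Product using (Σ; Σ-syntax; ∃-syntax; _×_; _,_; proj₁; proj₂; uncurry)
open import Data.Product.Properties using (≡-dec; ,-injective)
open import Data.Product.Relation.Binary.Lex.Strict using (×-Lex; ×-transitive; ×-antisymmetric; ×-total₂; ×-decidable)
open import Data.Product.Relation.Binary.Pointwise.NonDependent using (≡×≡⇒≡)
open import Data.Sum using (_⊎_; inj₁; inj₂)
open import Data.Vec using ([]; _∷_; lookup; replicate) renaming (_++_ to _++ᵛ_)
open import Data.Vec.Properties using (lookup∘tabulate; tabulate∘lookup; tabulate-cong; lookup-zipWith; lookup-replicate)
open import Function using (_∘_)
open import Function.Bundles using (_⇔_; mk⇔; Equivalence)
open import Function.Definitions using (Surjective)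
open import Level using (0ℓ)
open import Algebra.Properties.CommutativeMonoid.Sum +-0-commutativeMonoid using (sum-remove; sum-cong-≗; sum-permute; ∑-distrib-+) renaming (sum to ∑)
import Algebra.Construct.NaturalChoice.Max as Max
open import Axiom.UniquenessOfIdentityProofs using (module Decidable⇒UIP)
open import Relation.Binary.Bundles using (DecTotalOrder)
open import Relation.Binary.Core using (Rel)
open import Relation.Binary.Definitions using (DecidableEquality)
open import Relation.Binary.Structures using (IsStrictTotalOrder; IsDecTotalOrder)
open import Relation.Binary.PropositionalEquality hiding ([_])
open import Relation.Nullary using (¬_; yes; no; does)
open import Relation.Nullary.Decidable using (dec-true; dec-false; map′; _×-dec_)

indicator : Bool → ℕ
indicator true  = 1
indicator false = 0

count : ∀ {n} → (Fin n → Bool) → ℕ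
count P = ∑ (indicator ∘ P)

∣p∣≡count : ∀ {n} (A : Subset n) → ∣ A ∣ ≡ count (lookup A)
∣p∣≡count []            = refl
∣p∣≡count (inside  ∷ A) = cong suc (∣p∣≡count A)
∣p∣≡count (outside ∷ A) = ∣p∣≡count A

count-cong : ∀ {n} {P Q : Fin n → Bool} → (∀ i → P i ≡ Q i) → count P ≡ count Q
count-cong P≗Q = sum-cong-≗ (cong indicator ∘ P≗Q)

count-remove : ∀ {n} (P : Fin (suc n) → Bool) i → count P ≡ indicator (P i) + count (P ∘ punchIn i)
count-remove P i = sum-remove (indicator ∘ P)

1≤count⇒∃ : ∀ {n} (P : Fin n → Bool) → 1 ≤ count P → ∃[ i ] P i ≡ true
1≤count⇒∃ {suc n} P 1≤c with P zero in eq
... | true  = zero , eq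
... | false with i , Pi ← 1≤count⇒∃ (P ∘ suc) 1≤c = suc i , Pi

Subset-ext : ∀ {n} {A B : Subset n} → (∀ i → lookup A i ≡ lookup B i) → A ≡ B
Subset-ext {A = A} {B} A≗B = trans (sym (tabulate∘lookup A)) (trans (tabulate-cong A≗B) (tabulate∘lookup B))

module _ {K : Set} (_≟_ : DecidableEquality K) where

  fibreSize : ∀ {n} → (Fin n → K) → K → ℕ
  fibreSize c κ = count (λ i → does (c i ≟ κ))

  -- Send 0 to a position y where c′ has the colour of 0, and recurse on the remaining points.
  sameFibreSizes⇒permutation : ∀ {n} (c c′ : Fin n → K) → (∀ κ → fibreSize c κ ≡ fibreSize c′ κ) →
                               Σ[ σ ∈ Permutation′ n ] (∀ i → c′ (σ ⟨$⟩ʳ i) ≡ c i)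
  sameFibreSizes⇒permutation {zero}  c c′ same = Perm.id , λ ()
  sameFibreSizes⇒permutation {suc n} c c′ same = insert zero y τ , matches
    where
    κ₀ : K
    κ₀ = c zero
    found : ∃[ y ] does (c′ y ≟ κ₀) ≡ true
    found = 1≤count⇒∃ (λ i → does (c′ i ≟ κ₀))
      (subst (1 ≤_) (same κ₀) (subst (λ b → 1 ≤ indicator b + fibreSize (c ∘ suc) κ₀) (sym (dec-true (κ₀ ≟ κ₀) refl)) (s≤s z≤n)))
    y : Fin (suc n)
    y = proj₁ found
    c′y≡κ₀ : c′ y ≡ κ₀
    c′y≡κ₀ with c′ y ≟ κ₀ | proj₂ found
    ... | yes e | _ = e
    sameRest : ∀ κ → fibreSize (c ∘ suc) κ ≡ fibreSize (c′ ∘ punchIn y) κ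
    sameRest κ = +-cancelˡ-≡ (indicator (does (κ₀ ≟ κ))) _ _ (trans (same κ)
      (trans (count-remove (λ i → does (c′ i ≟ κ)) y) (cong (λ z → indicator (does (z ≟ κ)) + fibreSize (c′ ∘ punchIn y) κ) c′y≡κ₀)))
    rest : Σ[ τ ∈ Permutation′ n ] (∀ i → c′ (punchIn y (τ ⟨$⟩ʳ i)) ≡ c (suc i))
    rest = sameFibreSizes⇒permutation (c ∘ suc) (c′ ∘ punchIn y) sameRest
    τ : Permutation′ n
    τ = proj₁ rest
    matches : ∀ i → c′ (insert zero y τ ⟨$⟩ʳ i) ≡ c i
    matches zero    = c′y≡κ₀
    matches (suc i) = trans (cong c′ (insert-punchIn zero y τ i)) (proj₂ rest i)

lookup-∩ : ∀ {n} (A B : Subset n) i → lookup (A ∩ B) i ≡ lookup A i ∧ lookup B i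
lookup-∩ A B i = lookup-zipWith _∧_ i A B

module _ {p} (σ : Permutation′ p) where

  lookup-image : ∀ (A : Subset p) j → lookup (image σ A) j ≡ lookup A (σ ⟨$⟩ˡ j)
  lookup-image A = lookup∘tabulate (λ j → lookup A (σ ⟨$⟩ˡ j))

  image-∩ : ∀ (A B : Subset p) → image σ (A ∩ B) ≡ image σ A ∩ image σ B
  image-∩ A B = Subset-ext λ j → begin
    lookup (image σ (A ∩ B)) j                          ≡⟨ lookup-image (A ∩ B) j ⟩
    lookup (A ∩ B) (σ ⟨$⟩ˡ j)                            ≡⟨ lookup-∩ A B (σ ⟨$⟩ˡ j) ⟩
    lookup A (σ ⟨$⟩ˡ j) ∧ lookup B (σ ⟨$⟩ˡ j)            ≡⟨ sym (cong₂ _∧_ (lookup-image A j) (lookup-image B j)) ⟩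
    lookup (image σ A) j ∧ lookup (image σ B) j          ≡⟨ sym (lookup-∩ (image σ A) (image σ B) j) ⟩
    lookup (image σ A ∩ image σ B) j                    ∎
    where open ≡-Reasoning

  ∣image∣ : ∀ (A : Subset p) → ∣ image σ A ∣ ≡ ∣ A ∣
  ∣image∣ A = begin
    ∣ image σ A ∣                          ≡⟨ ∣p∣≡count (image σ A) ⟩
    count (lookup (image σ A))             ≡⟨ count-cong (lookup-image A) ⟩
    count (λ j → lookup A (σ ⟨$⟩ˡ j))      ≡⟨ sym (sum-permute (indicator ∘ lookup A) (Perm.flip σ)) ⟩
    count (lookup A)                       ≡⟨ sym (∣p∣≡count A) ⟩
    ∣ A ∣                                  ∎
    where open ≡-Reasoning

  image-injective : ∀ {A B : Subset p} → image σ A ≡ image σ B → A ≡ B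
  image-injective {A} {B} eq = Subset-ext λ i → begin
    lookup A i                             ≡⟨ cong (lookup A) (sym (inverseˡ σ)) ⟩
    lookup A (σ ⟨$⟩ˡ (σ ⟨$⟩ʳ i))           ≡⟨ sym (lookup-image A (σ ⟨$⟩ʳ i)) ⟩
    lookup (image σ A) (σ ⟨$⟩ʳ i)          ≡⟨ cong (λ C → lookup C (σ ⟨$⟩ʳ i)) eq ⟩
    lookup (image σ B) (σ ⟨$⟩ʳ i)          ≡⟨ lookup-image B (σ ⟨$⟩ʳ i) ⟩
    lookup B (σ ⟨$⟩ˡ (σ ⟨$⟩ʳ i))           ≡⟨ cong (lookup B) (inverseˡ σ) ⟩
    lookup B i                             ∎
    where open ≡-Reasoning

  image-≡ : ∀ {A A′ : Subset p} → (∀ i → lookup A′ (σ ⟨$⟩ʳ i) ≡ lookup A i) → image σ A ≡ A′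
  image-≡ {A} {A′} transported = Subset-ext λ j → begin
    lookup (image σ A) j                   ≡⟨ lookup-image A j ⟩
    lookup A (σ ⟨$⟩ˡ j)                    ≡⟨ sym (transported (σ ⟨$⟩ˡ j)) ⟩
    lookup A′ (σ ⟨$⟩ʳ (σ ⟨$⟩ˡ j))          ≡⟨ cong (lookup A′) (inverseʳ σ) ⟩
    lookup A′ j                            ∎
    where open ≡-Reasoning

-- The colouring of [p] by two disjoint pairs of subsets

data Side : Set where
  first second : Side

_≟ˢ_ : DecidableEquality Side
first  ≟ˢ first  = yes refl
first  ≟ˢ second = no λ ()
second ≟ˢ first  = no λ ()
second ≟ˢ second = yes refl

Slot : Set
Slot = Maybe Side

_≟ᵒ_ : DecidableEquality Slot
_≟ᵒ_ = Maybe.≡-dec _≟ˢ_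

∑Slot : (Slot → ℕ) → ℕ
∑Slot f = f nothing + f (just first) + f (just second)

∑Slot-cong : ∀ {f g : Slot → ℕ} → (∀ u → f u ≡ g u) → ∑Slot f ≡ ∑Slot g
∑Slot-cong f≗g = cong₂ _+_ (cong₂ _+_ (f≗g nothing) (f≗g (just first))) (f≗g (just second))

cancel-∑Slot : ∀ (f g : Slot → ℕ) → ∑Slot f ≡ ∑Slot g → (∀ s → f (just s) ≡ g (just s)) → f nothing ≡ g nothing
cancel-∑Slot f g eq fs≡gs = +-cancelʳ-≡ _ _ _ (+-cancelʳ-≡ _ _ _
  (trans eq (cong₂ (λ x y → g nothing + x + y) (sym (fs≡gs first)) (sym (fs≡gs second)))))

count-partition : ∀ {n} (P : Fin n → Bool) (c : Fin n → Slot) →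
                  ∑Slot (λ u → count (λ x → P x ∧ does (c x ≟ᵒ u))) ≡ count P
count-partition {n} P c = begin
  ∑Slot (λ u → count (P ∧ᶜ u))                             ≡⟨ cong (_+ count (P ∧ᶜ just second)) (∑-distrib-+ (𝟙 nothing) (𝟙 (just first))) ⟨
  ∑ (λ x → 𝟙 nothing x + 𝟙 (just first) x) + count (P ∧ᶜ just second)  ≡⟨ ∑-distrib-+ (λ x → 𝟙 nothing x + 𝟙 (just first) x) (𝟙 (just second)) ⟨
  ∑ (λ x → 𝟙 nothing x + 𝟙 (just first) x + 𝟙 (just second) x)         ≡⟨ sum-cong-≗ (λ x → pointwise (P x) (c x)) ⟩
  count P                                                  ∎
  where
  open ≡-Reasoning
  _∧ᶜ_ : (Fin n → Bool) → Slot → Fin n → Bool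
  (P ∧ᶜ u) x = P x ∧ does (c x ≟ᵒ u)
  𝟙 : Slot → Fin n → ℕ
  𝟙 u = indicator ∘ (P ∧ᶜ u)
  pointwise : ∀ b u → indicator (b ∧ does (u ≟ᵒ nothing)) + indicator (b ∧ does (u ≟ᵒ just first)) + indicator (b ∧ does (u ≟ᵒ just second)) ≡ indicator b
  pointwise false u = refl
  pointwise true nothing = refl
  pointwise true (just first) = refl
  pointwise true (just second) = refl

record DisjointPair (p : ℕ) : Set where
  field
    side     : Side → Subset p
    disjoint : side first ∩ side second ≡ ⊥
open DisjointPair public

Aligned : ∀ {p} → Permutation′ p → DisjointPair p → DisjointPair p → Set
Aligned σ X X′ = ∀ s → image σ (side X s) ≡ side X′ s

slotOf : Bool → Bool → Slot
slotOf true  _     = just first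
slotOf false true  = just second
slotOf false false = nothing

slot : ∀ {p} → DisjointPair p → Fin p → Slot
slot X x = slotOf (lookup (side X first) x) (lookup (side X second) x)

disjoint-pointwise : ∀ {p} (X : DisjointPair p) x → lookup (side X first) x ∧ lookup (side X second) x ≡ false
disjoint-pointwise X x = begin
  lookup (side X first) x ∧ lookup (side X second) x  ≡⟨ lookup-∩ (side X first) (side X second) x ⟨
  lookup (side X first ∩ side X second) x             ≡⟨ cong (λ A → lookup A x) (disjoint X) ⟩
  lookup ⊥ x                                          ≡⟨ lookup-replicate x false ⟩
  false                                               ∎
  where open ≡-Reasoning

slot-member : ∀ {p} (X : DisjointPair p) s x → does (slot X x ≟ᵒ just s) ≡ lookup (side X s) x
slot-member X first  x = slotOf-first (lookup (side X first) x) (lookup (side X second) x)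
  where
  slotOf-first : ∀ a b → does (slotOf a b ≟ᵒ just first) ≡ a
  slotOf-first true  _     = refl
  slotOf-first false true  = refl
  slotOf-first false false = refl
slot-member X second x = slotOf-second (lookup (side X first) x) (lookup (side X second) x) (disjoint-pointwise X x)
  where
  slotOf-second : ∀ a b → a ∧ b ≡ false → does (slotOf a b ≟ᵒ just second) ≡ b
  slotOf-second true  false _ = refl
  slotOf-second false true  _ = refl
  slotOf-second false false _ = refl

count-slot : ∀ {p} (X : DisjointPair p) s → count (λ x → does (slot X x ≟ᵒ just s)) ≡ ∣ side X s ∣
count-slot X s = trans (count-cong (slot-member X s)) (sym (∣p∣≡count (side X s)))

count-true : ∀ n → count {n} (λ _ → true) ≡ n
count-true zero    = refl
count-true (suc n) = cong suc (count-true n)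

∑Slot-count-slot : ∀ {p} (X : DisjointPair p) → ∑Slot (λ u → count (λ x → does (slot X x ≟ᵒ u))) ≡ p
∑Slot-count-slot {p} X = trans (count-partition (λ _ → true) (slot X)) (count-true p)

sameSizes⇒sameSlotCounts : ∀ {p} (Z Z′ : DisjointPair p) → (∀ s → ∣ side Z s ∣ ≡ ∣ side Z′ s ∣) →
                           ∀ u → count (λ x → does (slot Z x ≟ᵒ u)) ≡ count (λ x → does (slot Z′ x ≟ᵒ u))
sameSizes⇒sameSlotCounts Z Z′ sameZ (just s) = trans (count-slot Z s) (trans (sameZ s) (sym (count-slot Z′ s)))
sameSizes⇒sameSlotCounts Z Z′ sameZ nothing  =
  cancel-∑Slot (λ u → count (λ x → does (slot Z x ≟ᵒ u))) (λ u → count (λ x → does (slot Z′ x ≟ᵒ u)))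
    (trans (∑Slot-count-slot Z) (sym (∑Slot-count-slot Z′))) (sameSizes⇒sameSlotCounts Z Z′ sameZ ∘ just)

_≟ᶜ_ : DecidableEquality (Slot × Slot)
(u , v) ≟ᶜ (u′ , v′) = map′ (uncurry (cong₂ _,_)) ,-injective ((u ≟ᵒ u′) ×-dec (v ≟ᵒ v′))

slots⇒Aligned : ∀ {p} (σ : Permutation′ p) (X X′ : DisjointPair p) →
                (∀ x → slot X′ (σ ⟨$⟩ʳ x) ≡ slot X x) → Aligned σ X X′
slots⇒Aligned σ X X′ sameSlot s = image-≡ σ {side X s} λ x → begin
  lookup (side X′ s) (σ ⟨$⟩ʳ x)          ≡⟨ slot-member X′ s (σ ⟨$⟩ʳ x) ⟨
  does (slot X′ (σ ⟨$⟩ʳ x) ≟ᵒ just s)    ≡⟨ cong (λ u → does (u ≟ᵒ just s)) (sameSlot x) ⟩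
  does (slot X x ≟ᵒ just s)              ≡⟨ slot-member X s x ⟩
  lookup (side X s) x                    ∎
  where open ≡-Reasoning

module Colouring {p} (X Y : DisjointPair p) where

  colour : Fin p → Slot × Slot
  colour x = slot X x , slot Y x

  classSize : Slot → Slot → ℕ
  classSize u v = fibreSize _≟ᶜ_ colour (u , v)

  ∑Slot-row : ∀ u → ∑Slot (classSize u) ≡ count (λ x → does (slot X x ≟ᵒ u))
  ∑Slot-row u = count-partition (λ x → does (slot X x ≟ᵒ u)) (slot Y)

  ∑Slot-column : ∀ v → ∑Slot (λ u → classSize u v) ≡ count (λ x → does (slot Y x ≟ᵒ v))
  ∑Slot-column v = trans (∑Slot-cong swap) (count-partition (λ x → does (slot Y x ≟ᵒ v)) (slot X))
    where
    swap : ∀ u → classSize u v ≡ count (λ x → does (slot Y x ≟ᵒ v) ∧ does (slot X x ≟ᵒ u))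
    swap u = count-cong λ x → ∧-comm (does (slot X x ≟ᵒ u)) _

  classSize-∩ : ∀ s t → classSize (just s) (just t) ≡ ∣ side X s ∩ side Y t ∣
  classSize-∩ s t = begin
    classSize (just s) (just t)                              ≡⟨ count-cong (λ x → cong₂ _∧_ (slot-member X s x) (slot-member Y t x)) ⟩
    count (λ x → lookup (side X s) x ∧ lookup (side Y t) x)  ≡⟨ count-cong (lookup-∩ (side X s) (side Y t)) ⟨
    count (lookup (side X s ∩ side Y t))                     ≡⟨ ∣p∣≡count (side X s ∩ side Y t) ⟨
    ∣ side X s ∩ side Y t ∣                                  ∎
    where open ≡-Reasoning

-- Colour each point by its slots in X and in Y. Of the nine colour classes, the four meeting
-- X s ∩ Y t are given; the others follow by cancellation from the row and column sums, which
-- are fixed by the sizes of the sides and by p. Equal class sizes yield the permutation.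
transport : ∀ {p} (X Y X′ Y′ : DisjointPair p) →
            (∀ s → ∣ side X s ∣ ≡ ∣ side X′ s ∣) → (∀ t → ∣ side Y t ∣ ≡ ∣ side Y′ t ∣) →
            (∀ s t → ∣ side X s ∩ side Y t ∣ ≡ ∣ side X′ s ∩ side Y′ t ∣) →
            Σ[ σ ∈ Permutation′ p ] Aligned σ X X′ × Aligned σ Y Y′
transport {p} X Y X′ Y′ sameX sameY same∩ =
  σ , slots⇒Aligned σ X X′ (cong proj₁ ∘ proj₂ permuted) , slots⇒Aligned σ Y Y′ (cong proj₂ ∘ proj₂ permuted)
  where
  module C  = Colouring X Y
  module C′ = Colouring X′ Y′

  sameColumn : ∀ u t → C.classSize u (just t) ≡ C′.classSize u (just t)
  sameColumn (just s) t = trans (C.classSize-∩ s t) (trans (same∩ s t) (sym (C′.classSize-∩ s t)))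
  sameColumn nothing  t = cancel-∑Slot (λ u → C.classSize u (just t)) (λ u → C′.classSize u (just t))
    (trans (C.∑Slot-column (just t)) (trans (sameSizes⇒sameSlotCounts Y Y′ sameY (just t)) (sym (C′.∑Slot-column (just t)))))
    (λ s → sameColumn (just s) t)

  sameClass : ∀ u v → C.classSize u v ≡ C′.classSize u v
  sameClass u (just t) = sameColumn u t
  sameClass u nothing  = cancel-∑Slot (C.classSize u) (C′.classSize u)
    (trans (C.∑Slot-row u) (trans (sameSizes⇒sameSlotCounts X X′ sameX u) (sym (C′.∑Slot-row u))))
    (sameColumn u)

  permuted : Σ[ σ ∈ Permutation′ p ] (∀ x → C′.colour (σ ⟨$⟩ʳ x) ≡ C.colour x)
  permuted = sameFibreSizes⇒permutation _≟ᶜ_ C.colour C′.colour (uncurry sameClass)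
  σ : Permutation′ p
  σ = proj₁ permuted

∑Slot-just≤ : ∀ f → f (just first) + f (just second) ≤ ∑Slot f
∑Slot-just≤ f = ≤-trans (m≤n+m _ (f nothing)) (≤-reflexive (sym (+-assoc (f nothing) _ _)))

module _ {p} (X Y : DisjointPair p) where
  open Colouring X Y

  ∩-row≤ : ∀ s → ∣ side X s ∩ side Y first ∣ + ∣ side X s ∩ side Y second ∣ ≤ ∣ side X s ∣
  ∩-row≤ s = subst₂ _≤_ (cong₂ _+_ (classSize-∩ s first) (classSize-∩ s second))
    (trans (∑Slot-row (just s)) (count-slot X s)) (∑Slot-just≤ (classSize (just s)))

  ∩-column≤ : ∀ t → ∣ side X first ∩ side Y t ∣ + ∣ side X second ∩ side Y t ∣ ≤ ∣ side Y t ∣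
  ∩-column≤ t = subst₂ _≤_ (cong₂ _+_ (classSize-∩ first t) (classSize-∩ second t))
    (trans (∑Slot-column (just t)) (count-slot Y t)) (∑Slot-just≤ (λ u → classSize u (just t)))

-- Pairs of families and their intersection matrices

flipSide : Side → Side
flipSide first  = second
flipSide second = first

swapSides : ∀ {p} → DisjointPair p → DisjointPair p
swapSides X = record { side = side X ∘ flipSide ; disjoint = trans (∩-comm _ _) (disjoint X) }

swapIf : ∀ {p} → Bool → DisjointPair p → DisjointPair p
swapIf false X = X
swapIf true  X = swapSides X

module _ {A : Set} where

  element : Side → (xs : List A) → length xs ≡ 2 → A
  element first  (x ∷ _ ∷ []) _ = x
  element second (_ ∷ y ∷ []) _ = y

  elements : ∀ xs (len : length xs ≡ 2) → xs ≡ element first xs len ∷ element second xs len ∷ []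
  elements (_ ∷ _ ∷ []) _ = refl

  All-element : ∀ {P : A → Set} {xs} (len : length xs ≡ 2) → All P xs → ∀ s → P (element s xs len)
  All-element {xs = _ ∷ _ ∷ []} _ (px ∷ _ ∷ []) first  = px
  All-element {xs = _ ∷ _ ∷ []} _ (_ ∷ py ∷ []) second = py

  AllPairs-elements : ∀ {R : A → A → Set} {xs} (len : length xs ≡ 2) → AllPairs R xs →
                      R (element first xs len) (element second xs len)
  AllPairs-elements {xs = _ ∷ _ ∷ []} _ ((rxy ∷ []) ∷ _) = rxy

module _ {p q : ℕ} (S : Family p q 2) where

  pairOf : DisjointPair p
  pairOf = record
    { side     = λ s → element s (members S) (size S)
    ; disjoint = AllPairs-elements (size S) (disjoint S)
    }

  members≡ : members S ≡ side pairOf first ∷ side pairOf second ∷ []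
  members≡ = elements (members S) (size S)

  ∣side∣ : ∀ s → ∣ side pairOf s ∣ ≡ q
  ∣side∣ = All-element (size S) (qsubsets S)

  sides-distinct : side pairOf first ≢ side pairOf second
  sides-distinct = AllPairs-elements (size S) (unique S)

module _ {p q : ℕ} (σ : Permutation′ p) (S S′ : Family p q 2) where

  private
    X  = pairOf S
    X′ = pairOf S′

    mapsInto≡ : MapsInto σ S S′ ≡ All (λ A → image σ A ∈ side X′ first ∷ side X′ second ∷ []) (side X first ∷ side X second ∷ [])
    mapsInto≡ = cong₂ (λ xs ys → All (λ A → image σ A ∈ ys) xs) (members≡ S) (members≡ S′)

    collapse : ∀ {A′} {B : Set} → image σ (side X first) ≡ A′ → image σ (side X second) ≡ A′ → B
    collapse e₁ e₂ = ⊥-elim (sides-distinct S (image-injective σ (trans e₁ (sym e₂))))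

  mapsInto⇒Aligned : MapsInto σ S S′ → ∃[ b ] Aligned σ X (swapIf b X′)
  mapsInto⇒Aligned m with subst (λ P → P) mapsInto≡ m
  ... | here e₁         ∷ here e₂         ∷ [] = collapse e₁ e₂
  ... | here e₁         ∷ there (here e₂) ∷ [] = false , λ { first → e₁ ; second → e₂ }
  ... | there (here e₁) ∷ here e₂         ∷ [] = true  , λ { first → e₁ ; second → e₂ }
  ... | there (here e₁) ∷ there (here e₂) ∷ [] = collapse e₁ e₂

  Aligned⇒mapsInto : ∀ b → Aligned σ X (swapIf b X′) → MapsInto σ S S′
  Aligned⇒mapsInto b aligned = subst (λ P → P) (sym mapsInto≡) (into b aligned)
    where
    into : ∀ b → Aligned σ X (swapIf b X′) → All (λ A → image σ A ∈ side X′ first ∷ side X′ second ∷ []) (side X first ∷ side X second ∷ [])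
    into false al = here (al first) ∷ there (here (al second)) ∷ []
    into true  al = there (here (al first)) ∷ here (al second) ∷ []

Tup : Set
Tup = ℕ × ℕ × ℕ × ℕ

meets : ∀ {p} → DisjointPair p → DisjointPair p → Tup
meets X Y = m first first , m first second , m second first , m second second
  where
  m : Side → Side → ℕ
  m s t = ∣ side X s ∩ side Y t ∣

Aligned⇒meets : ∀ {p} (σ : Permutation′ p) (X Y X′ Y′ : DisjointPair p) → Aligned σ X X′ → Aligned σ Y Y′ → meets X Y ≡ meets X′ Y′
Aligned⇒meets σ X Y X′ Y′ alX alY = cong₂ _,_ (same first first) (cong₂ _,_ (same first second) (cong₂ _,_ (same second first) (same second second)))
  where
  same : ∀ s t → ∣ side X s ∩ side Y t ∣ ≡ ∣ side X′ s ∩ side Y′ t ∣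
  same s t = begin
    ∣ side X s ∩ side Y t ∣                     ≡⟨ ∣image∣ σ (side X s ∩ side Y t) ⟨
    ∣ image σ (side X s ∩ side Y t) ∣           ≡⟨ cong ∣_∣ (image-∩ σ (side X s) (side Y t)) ⟩
    ∣ image σ (side X s) ∩ image σ (side Y t) ∣ ≡⟨ cong₂ (λ A B → ∣ A ∩ B ∣) (alX s) (alY t) ⟩
    ∣ side X′ s ∩ side Y′ t ∣                   ∎
    where open ≡-Reasoning

meets-injective : ∀ {p} (X Y X′ Y′ : DisjointPair p) → meets X Y ≡ meets X′ Y′ →
                  ∀ s t → ∣ side X s ∩ side Y t ∣ ≡ ∣ side X′ s ∩ side Y′ t ∣
meets-injective _ _ _ _ eq first  first  = cong proj₁ eq
meets-injective _ _ _ _ eq first  second = cong (proj₁ ∘ proj₂) eq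
meets-injective _ _ _ _ eq second first  = cong (proj₁ ∘ proj₂ ∘ proj₂) eq
meets-injective _ _ _ _ eq second second = cong (proj₂ ∘ proj₂ ∘ proj₂) eq

Klein : Set
Klein = Bool × Bool

-- (true , _) exchanges the two rows of the 2×2 matrix (a b / c d), (_ , true) its two columns.
act : Klein → Tup → Tup
act (false , false) t               = t
act (true  , false) (a , b , c , d) = c , d , a , b
act (false , true ) (a , b , c , d) = b , a , d , c
act (true  , true ) (a , b , c , d) = d , c , b , a

_∙_ : Klein → Klein → Klein
(a , b) ∙ (c , d) = a xor c , b xor d

act-∙ : ∀ g h t → act g (act h t) ≡ act (g ∙ h) t
act-∙ (false , false) h               t = refl
act-∙ (true  , false) (false , false) t = refl
act-∙ (true  , false) (true  , false) t = refl
act-∙ (true  , false) (false , true ) t = refl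
act-∙ (true  , false) (true  , true ) t = refl
act-∙ (false , true ) (false , false) t = refl
act-∙ (false , true ) (true  , false) t = refl
act-∙ (false , true ) (false , true ) t = refl
act-∙ (false , true ) (true  , true ) t = refl
act-∙ (true  , true ) (false , false) t = refl
act-∙ (true  , true ) (true  , false) t = refl
act-∙ (true  , true ) (false , true ) t = refl
act-∙ (true  , true ) (true  , true ) t = refl

act-involutive : ∀ g t → act g (act g t) ≡ t
act-involutive (false , false) t = refl
act-involutive (true  , false) t = refl
act-involutive (false , true ) t = refl
act-involutive (true  , true ) t = refl

swapPairs : ∀ {p} → Klein → DisjointPair p × DisjointPair p → DisjointPair p × DisjointPair p
swapPairs (b₁ , b₂) (X , Y) = swapIf b₁ X , swapIf b₂ Y

meets-swapPairs : ∀ {p} g (X Y : DisjointPair p) → uncurry meets (swapPairs g (X , Y)) ≡ act g (meets X Y)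
meets-swapPairs (false , false) X Y = refl
meets-swapPairs (true  , false) X Y = refl
meets-swapPairs (false , true ) X Y = refl
meets-swapPairs (true  , true ) X Y = refl

-- Canonical representatives under exchanging rows and columns

×-Lex-isDecTotalOrder : ∀ {a b ℓ₁ ℓ₂} {A : Set a} {B : Set b} {_<₁_ : Rel A ℓ₁} {_≤₂_ : Rel B ℓ₂} →
                        IsStrictTotalOrder _≡_ _<₁_ → IsDecTotalOrder _≡_ _≤₂_ →
                        IsDecTotalOrder _≡_ (×-Lex _≡_ _<₁_ _≤₂_)
×-Lex-isDecTotalOrder {_<₁_ = _<₁_} {_≤₂_} sto dto = record
  { isTotalOrder = record
    { isPartialOrder = record
      { isPreorder = record
        { isEquivalence = isEquivalence
        ; reflexive     = λ { refl → inj₂ (refl , D.refl) }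
        ; trans         = ×-transitive {_<₂_ = _≤₂_} isEquivalence (resp₂ _<₁_) S.trans D.trans
        }
      ; antisym = λ x≤y y≤x → ≡×≡⇒≡ (×-antisymmetric {_<₁_ = _<₁_} {_≈₂_ = _≡_} sym S.irrefl S.asym D.antisym x≤y y≤x)
      }
    ; total = ×-total₂ sym S.compare D.total
    }
  ; _≟_  = ≡-dec S._≟_ D._≟_
  ; _≤?_ = ×-decidable S._≟_ S._<?_ D._≤?_
  }
  where
  module S = IsStrictTotalOrder sto
  module D = IsDecTotalOrder dto

infix 4 _≤ₗ_

_≤ₗ_ : Rel Tup 0ℓ
_≤ₗ_ = ×-Lex _≡_ _<_ (×-Lex _≡_ _<_ (×-Lex _≡_ _<_ _≤_))

≤ₗ-isDecTotalOrder : IsDecTotalOrder _≡_ _≤ₗ_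
≤ₗ-isDecTotalOrder = ×-Lex-isDecTotalOrder <-isStrictTotalOrder
  (×-Lex-isDecTotalOrder <-isStrictTotalOrder (×-Lex-isDecTotalOrder <-isStrictTotalOrder ≤-isDecTotalOrder))

≤ₗ-decTotalOrder : DecTotalOrder 0ℓ 0ℓ 0ℓ
≤ₗ-decTotalOrder = record { isDecTotalOrder = ≤ₗ-isDecTotalOrder }

open DecTotalOrder ≤ₗ-decTotalOrder using () renaming (refl to ≤ₗ-refl; trans to ≤ₗ-trans; antisym to ≤ₗ-antisym)
open Max (DecTotalOrder.totalOrder ≤ₗ-decTotalOrder) using (_⊔_; x≤x⊔y; x≤y⊔x; ⊔-sel)

opaque
  canon : Tup → Tup
  canon t = (act (false , false) t ⊔ act (true , false) t) ⊔ (act (false , true) t ⊔ act (true , true) t)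

⊔-preserves : ∀ (P : Tup → Set) x y → P x → P y → P (x ⊔ y)
⊔-preserves P x y px py with ⊔-sel x y
... | inj₁ eq = subst P (sym eq) px
... | inj₂ eq = subst P (sym eq) py

opaque
  unfolding canon

  canon-∈-orbit : ∀ t → ∃[ g ] canon t ≡ act g t
  canon-∈-orbit t = ⊔-preserves InOrbit _ _
    (⊔-preserves InOrbit _ _ ((false , false) , refl) ((true , false) , refl))
    (⊔-preserves InOrbit _ _ ((false , true) , refl) ((true , true) , refl))
    where
    InOrbit : Tup → Set
    InOrbit u = ∃[ g ] u ≡ act g t

  canon-upper : ∀ g t → act g t ≤ₗ canon t
  canon-upper g t = upper g
    where
    ee re ec rc : Tup
    ee = act (false , false) t ; re = act (true , false) t ; ec = act (false , true) t ; rc = act (true , true) t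
    left : ∀ {u} → u ≤ₗ ee ⊔ re → u ≤ₗ canon t
    left {u} u≤ = ≤ₗ-trans {u} {ee ⊔ re} {canon t} u≤ (x≤x⊔y (ee ⊔ re) (ec ⊔ rc))
    right : ∀ {u} → u ≤ₗ ec ⊔ rc → u ≤ₗ canon t
    right {u} u≤ = ≤ₗ-trans {u} {ec ⊔ rc} {canon t} u≤ (x≤y⊔x (ee ⊔ re) (ec ⊔ rc))
    upper : ∀ g → act g t ≤ₗ canon t
    upper (false , false) = left (x≤x⊔y ee re)
    upper (true  , false) = left (x≤y⊔x ee re)
    upper (false , true ) = right (x≤x⊔y ec rc)
    upper (true  , true ) = right (x≤y⊔x ec rc)

-- canon (h t) is some g (h t) = (g ∙ h) t, and canon t is some g t = g (h (h t)) = (g ∙ h) (h t).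
canon-act : ∀ h t → canon (act h t) ≡ canon t
canon-act h t = ≤ₗ-antisym below above
  where
  below : canon (act h t) ≤ₗ canon t
  below with g , eq ← canon-∈-orbit (act h t) =
    subst (_≤ₗ canon t) (sym (trans eq (act-∙ g h t))) (canon-upper (g ∙ h) t)
  above : canon t ≤ₗ canon (act h t)
  above with g , eq ← canon-∈-orbit t =
    subst (_≤ₗ canon (act h t)) (sym (trans eq (trans (cong (act g) (sym (act-involutive h t))) (act-∙ g h (act h t)))))
          (canon-upper (g ∙ h) (act h t))

canon-idempotent : ∀ t → canon (canon t) ≡ canon t
canon-idempotent t with h , eq ← canon-∈-orbit t = trans (cong canon eq) (canon-act h t)

canon≡⇒orbit : ∀ {t t′} → canon t ≡ canon t′ → ∃[ g ] t′ ≡ act g t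
canon≡⇒orbit {t} {t′} same with g , eq ← canon-∈-orbit t | g′ , eq′ ← canon-∈-orbit t′ = g′ ∙ g , (begin
  t′                   ≡⟨ act-involutive g′ t′ ⟨
  act g′ (act g′ t′)   ≡⟨ cong (act g′) (trans (sym eq′) (trans (sym same) eq)) ⟩
  act g′ (act g t)     ≡⟨ act-∙ g′ g t ⟩
  act (g′ ∙ g) t       ∎)
  where open ≡-Reasoning

Canonical : Tup → Set
Canonical t = ∀ g → act g t ≤ₗ t

canon-canonical : ∀ t → Canonical (canon t)
canon-canonical t g = subst (act g (canon t) ≤ₗ_) (canon-idempotent t) (canon-upper g (canon t))

canonical⇒canon≡ : ∀ {t} → Canonical t → canon t ≡ t
canonical⇒canon≡ {t} canonical with g , eq ← canon-∈-orbit t =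
  ≤ₗ-antisym (subst (_≤ₗ t) (sym eq) (canonical g)) (canon-upper (false , false) t)

-- The canonical intersection matrix is a complete invariant

Bounded : ℕ → Tup → Set
Bounded q (a , b , c , d) = a + b ≤ q × c + d ≤ q × a + c ≤ q × b + d ≤ q

Bounded-act : ∀ {q} g t → Bounded q t → Bounded q (act g t)
Bounded-act (false , false) t bounded = bounded
Bounded-act {q} (true , false) (a , b , c , d) (ab , cd , ac , bd) = cd , ab , subst (_≤ q) (+-comm a c) ac , subst (_≤ q) (+-comm b d) bd
Bounded-act {q} (false , true) (a , b , c , d) (ab , cd , ac , bd) = subst (_≤ q) (+-comm a b) ab , subst (_≤ q) (+-comm c d) cd , bd , ac
Bounded-act {q} (true , true) (a , b , c , d) (ab , cd , ac , bd) = subst (_≤ q) (+-comm c d) cd , subst (_≤ q) (+-comm a b) ab , subst (_≤ q) (+-comm b d) bd , subst (_≤ q) (+-comm a c) ac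

Bounded-canon : ∀ {q} t → Bounded q t → Bounded q (canon t)
Bounded-canon {q} t bounded with g , eq ← canon-∈-orbit t = subst (Bounded q) (sym eq) (Bounded-act g t bounded)

swapPairs-undoes : ∀ {p} g (X Y X′ Y′ : DisjointPair p) → meets X′ Y′ ≡ act g (meets X Y) →
                   meets X Y ≡ uncurry meets (swapPairs g (X′ , Y′))
swapPairs-undoes g X Y X′ Y′ eq = begin
  meets X Y                             ≡⟨ act-involutive g (meets X Y) ⟨
  act g (act g (meets X Y))             ≡⟨ cong (act g) eq ⟨
  act g (meets X′ Y′)                   ≡⟨ meets-swapPairs g X′ Y′ ⟨
  uncurry meets (swapPairs g (X′ , Y′)) ∎
  where open ≡-Reasoning

module _ {p q : ℕ} where

  meetsOf : Family p q 2 × Family p q 2 → Tup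
  meetsOf (S , T) = meets (pairOf S) (pairOf T)

  meetsOf-bounded : ∀ x → Bounded q (meetsOf x)
  meetsOf-bounded (S , T) =
    row first , row second , column first , column second
    where
    X Y : Side → Subset p
    X = side (pairOf S)
    Y = side (pairOf T)
    row : ∀ s → ∣ X s ∩ Y first ∣ + ∣ X s ∩ Y second ∣ ≤ q
    row s = subst (∣ X s ∩ Y first ∣ + ∣ X s ∩ Y second ∣ ≤_) (∣side∣ S s) (∩-row≤ (pairOf S) (pairOf T) s)
    column : ∀ t → ∣ X first ∩ Y t ∣ + ∣ X second ∩ Y t ∣ ≤ q
    column t = subst (∣ X first ∩ Y t ∣ + ∣ X second ∩ Y t ∣ ≤_) (∣side∣ T t) (∩-column≤ (pairOf S) (pairOf T) t)

  ∣side∣-swapIf : ∀ (S : Family p q 2) b s → ∣ side (swapIf b (pairOf S)) s ∣ ≡ q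
  ∣side∣-swapIf S false s = ∣side∣ S s
  ∣side∣-swapIf S true  s = ∣side∣ S (flipSide s)

  ∼⇒canon≡ : ∀ {x y} → x ∼ y → canon (meetsOf x) ≡ canon (meetsOf y)
  ∼⇒canon≡ {S , T} {S′ , T′} (σ , S↦S′ , T↦T′)
    with b₁ , alignedS ← mapsInto⇒Aligned σ S S′ S↦S′ | b₂ , alignedT ← mapsInto⇒Aligned σ T T′ T↦T′ = begin
    canon (meetsOf (S , T))                                          ≡⟨ cong canon (Aligned⇒meets σ (pairOf S) (pairOf T) (swapIf b₁ (pairOf S′)) (swapIf b₂ (pairOf T′)) alignedS alignedT) ⟩
    canon (meets (swapIf b₁ (pairOf S′)) (swapIf b₂ (pairOf T′)))    ≡⟨ cong canon (meets-swapPairs (b₁ , b₂) (pairOf S′) (pairOf T′)) ⟩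
    canon (act (b₁ , b₂) (meetsOf (S′ , T′)))                        ≡⟨ canon-act (b₁ , b₂) (meetsOf (S′ , T′)) ⟩
    canon (meetsOf (S′ , T′))                                        ∎
    where open ≡-Reasoning

  canon≡⇒∼ : ∀ {x y} → canon (meetsOf x) ≡ canon (meetsOf y) → x ∼ y
  canon≡⇒∼ {S , T} {S′ , T′} same with (b₁ , b₂) , eq ← canon≡⇒orbit same
    with σ , alignedS , alignedT ← transport (pairOf S) (pairOf T) (swapIf b₁ (pairOf S′)) (swapIf b₂ (pairOf T′))
           (λ s → trans (∣side∣ S s) (sym (∣side∣-swapIf S′ b₁ s)))
           (λ t → trans (∣side∣ T t) (sym (∣side∣-swapIf T′ b₂ t)))
           (meets-injective (pairOf S) (pairOf T) (swapIf b₁ (pairOf S′)) (swapIf b₂ (pairOf T′)) (swapPairs-undoes (b₁ , b₂) (pairOf S) (pairOf T) (pairOf S′) (pairOf T′) eq))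
    = σ , Aligned⇒mapsInto σ S S′ b₁ alignedS , Aligned⇒mapsInto σ T T′ b₂ alignedT

-- Realising bounded matrices when p ≥ 4q

∣p∣≡0⇒p≡⊥ : ∀ {n} (A : Subset n) → ∣ A ∣ ≡ 0 → A ≡ ⊥
∣p∣≡0⇒p≡⊥ []            _    = refl
∣p∣≡0⇒p≡⊥ (outside ∷ A) ∣A∣≡0 = cong (outside ∷_) (∣p∣≡0⇒p≡⊥ A ∣A∣≡0)

disjoint⇒distinct : ∀ {n} {A B : Subset n} → 1 ≤ ∣ A ∣ → A ∩ B ≡ ⊥ → A ≢ B
disjoint⇒distinct {n} {A} 1≤∣A∣ A∩B≡⊥ refl =
  1+n≰n (≤-trans 1≤∣A∣ (≤-reflexive (trans (cong ∣_∣ (trans (sym (∩-idem A)) A∩B≡⊥)) (∣⊥∣≡0 n))))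

pairFamily : ∀ {p q} (A B : Subset p) → 1 ≤ q → ∣ A ∣ ≡ q → ∣ B ∣ ≡ q → A ∩ B ≡ ⊥ → Family p q 2
pairFamily A B 1≤q ∣A∣≡q ∣B∣≡q A∩B≡⊥ = family (A ∷ B ∷ [])
  ((disjoint⇒distinct (subst (1 ≤_) (sym ∣A∣≡q) 1≤q) A∩B≡⊥ ∷ []) ∷ [] ∷ [])
  refl (∣A∣≡q ∷ ∣B∣≡q ∷ []) ((A∩B≡⊥ ∷ []) ∷ [] ∷ [])

-- Positions cut into consecutive blocks of the given lengths; P selects blocks by their index.
blocks : (ls : List ℕ) → (ℕ → Bool) → Subset (sum ls)
blocks []       P = []
blocks (l ∷ ls) P = replicate l (P 0) ++ᵛ blocks ls (P ∘ suc)

weight : (ℕ → Bool) → List ℕ → ℕ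
weight P []       = 0
weight P (l ∷ ls) = (if P 0 then l else 0) + weight (P ∘ suc) ls

∣replicate++∣ : ∀ {n} l b (A : Subset n) → ∣ replicate l b ++ᵛ A ∣ ≡ (if b then l else 0) + ∣ A ∣
∣replicate++∣ zero    true  A = refl
∣replicate++∣ zero    false A = refl
∣replicate++∣ (suc l) true  A = cong suc (∣replicate++∣ l true A)
∣replicate++∣ (suc l) false A = ∣replicate++∣ l false A

∩-replicate++ : ∀ {n} l a b (A B : Subset n) → (replicate l a ++ᵛ A) ∩ (replicate l b ++ᵛ B) ≡ replicate l (a ∧ b) ++ᵛ (A ∩ B)
∩-replicate++ zero    a b A B = refl
∩-replicate++ (suc l) a b A B = cong (a ∧ b ∷_) (∩-replicate++ l a b A B)

∣blocks∣ : ∀ ls P → ∣ blocks ls P ∣ ≡ weight P ls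
∣blocks∣ []       P = refl
∣blocks∣ (l ∷ ls) P = trans (∣replicate++∣ l (P 0) (blocks ls (P ∘ suc))) (cong (_ +_) (∣blocks∣ ls (P ∘ suc)))

blocks-∩ : ∀ ls P Q → blocks ls P ∩ blocks ls Q ≡ blocks ls (λ k → P k ∧ Q k)
blocks-∩ []       P Q = refl
blocks-∩ (l ∷ ls) P Q = trans (∩-replicate++ l (P 0) (Q 0) _ _) (cong (replicate l (P 0 ∧ Q 0) ++ᵛ_) (blocks-∩ ls (P ∘ suc) (Q ∘ suc)))

∣blocks-∩∣ : ∀ ls P Q → ∣ blocks ls P ∩ blocks ls Q ∣ ≡ weight (λ k → P k ∧ Q k) ls
∣blocks-∩∣ ls P Q = trans (cong ∣_∣ (blocks-∩ ls P Q)) (∣blocks∣ ls (λ k → P k ∧ Q k))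

blocks-disjoint : ∀ ls P Q → weight (λ k → P k ∧ Q k) ls ≡ 0 → blocks ls P ∩ blocks ls Q ≡ ⊥
blocks-disjoint ls P Q w≡0 = ∣p∣≡0⇒p≡⊥ _ (trans (∣blocks-∩∣ ls P Q) w≡0)

padding : ∀ {q} x y → x + y ≤ q → x + (y + (q ∸ (x + y) + 0)) ≡ q
padding {q} x y x+y≤q = trans (regroup x y (q ∸ (x + y))) (m+[n∸m]≡n x+y≤q)
  where
  regroup : ∀ x y z → x + (y + (z + 0)) ≡ x + y + z
  regroup = solve-∀

-- Blocks 0 1 | 2 and 3 4 | 5 will be the members of S, blocks 0 3 | 6 and 1 4 | 7 those of T;
-- blocks 2, 5, 6 and 7 pad them up to size q.
layout : ℕ → Tup → List ℕ
layout q (a , b , c , d) = a ∷ b ∷ q ∸ (a + b) ∷ c ∷ d ∷ q ∸ (c + d) ∷ q ∸ (a + c) ∷ q ∸ (b + d) ∷ []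

sum-layout≤ : ∀ {q} t → Bounded q t → sum (layout q t) ≤ 4 * q
sum-layout≤ {q} (a , b , c , d) (ab≤q , cd≤q , ac≤q , bd≤q) =
  ≤-trans (≤-trans (m≤m+n _ (a + c)) (m≤m+n _ (b + d))) (≤-reflexive (trans
    (regroup a b c d (q ∸ (a + b)) (q ∸ (c + d)) (q ∸ (a + c)) (q ∸ (b + d)))
    (trans (cong₂ _+_ (cong₂ _+_ (cong₂ _+_ (m+[n∸m]≡n ab≤q) (m+[n∸m]≡n cd≤q)) (m∸n+n≡m ac≤q)) (m∸n+n≡m bd≤q))
           (four q))))
  where
  four : ∀ q → q + q + q + q ≡ 4 * q
  four = solve-∀
  regroup : ∀ a b c d x₁ x₂ x₃ x₄ →
    a + (b + (x₁ + (c + (d + (x₂ + (x₃ + (x₄ + 0))))))) + (a + c) + (b + d) ≡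
    (a + b + x₁) + (c + d + x₂) + (x₃ + (a + c)) + (x₄ + (b + d))
  regroup = solve-∀

inA₁ inA₂ inB₁ inB₂ : ℕ → Bool
inA₁ k = any (k ≡ᵇ_) (0 ∷ 1 ∷ 2 ∷ [])
inA₂ k = any (k ≡ᵇ_) (3 ∷ 4 ∷ 5 ∷ [])
inB₁ k = any (k ≡ᵇ_) (0 ∷ 3 ∷ 6 ∷ [])
inB₂ k = any (k ≡ᵇ_) (1 ∷ 4 ∷ 7 ∷ [])

realize : ∀ {p q} → 1 ≤ q → 4 * q ≤ p → ∀ t → Bounded q t → ∃[ x ] meetsOf {p} {q} x ≡ t
realize {p} {q} 1≤q 4q≤p t@(a , b , c , d) bounded@(ab≤q , cd≤q , ac≤q , bd≤q) =
  subst (λ n → ∃[ x ] meetsOf {n} {q} x ≡ t) sum≡p ((S , T) , meetsST)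
  where
  ls : List ℕ
  ls = layout q t ++ [ p ∸ sum (layout q t) ]

  sum≡p : sum ls ≡ p
  sum≡p = trans (sum-++ (layout q t) [ p ∸ sum (layout q t) ])
    (trans (cong (sum (layout q t) +_) (+-identityʳ _)) (m+[n∸m]≡n (≤-trans (sum-layout≤ t bounded) 4q≤p)))

  S T : Family (sum ls) q 2
  S = pairFamily (blocks ls inA₁) (blocks ls inA₂) 1≤q
        (trans (∣blocks∣ ls inA₁) (padding a b ab≤q)) (trans (∣blocks∣ ls inA₂) (padding c d cd≤q))
        (blocks-disjoint ls inA₁ inA₂ refl)
  T = pairFamily (blocks ls inB₁) (blocks ls inB₂) 1≤q
        (trans (∣blocks∣ ls inB₁) (padding a c ac≤q)) (trans (∣blocks∣ ls inB₂) (padding b d bd≤q))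
        (blocks-disjoint ls inB₁ inB₂ refl)

  meetsST : meetsOf (S , T) ≡ t
  meetsST = cong₂ _,_ (single inA₁ inB₁ a refl) (cong₂ _,_ (single inA₁ inB₂ b refl) (cong₂ _,_ (single inA₂ inB₁ c refl) (single inA₂ inB₂ d refl)))
    where
    single : ∀ P Q x → weight (λ k → P k ∧ Q k) ls ≡ x + 0 → ∣ blocks ls P ∩ blocks ls Q ∣ ≡ x
    single P Q x w≡x = trans (∣blocks-∩∣ ls P Q) (trans w≡x (+-identityʳ x))

∑< : ℕ → (ℕ → ℕ) → ℕ
∑< zero    f = 0
∑< (suc n) f = ∑< n f + f n

∑<-cong : ∀ n {f g : ℕ → ℕ} → (∀ i → i < n → f i ≡ g i) → ∑< n f ≡ ∑< n g
∑<-cong zero    f≗g = refl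
∑<-cong (suc n) f≗g = cong₂ _+_ (∑<-cong n λ i i<n → f≗g i (m<n⇒m<1+n i<n)) (f≗g n ≤-refl)

∑<-const : ∀ n c → ∑< n (λ _ → c) ≡ n * c
∑<-const zero    c = refl
∑<-const (suc n) c = trans (cong (_+ c) (∑<-const n c)) (+-comm (n * c) c)

module _ {A : Set} where

  -- Opaque, so that n and f are recovered by unification from a goal ⋃ n f.
  opaque
    ⋃ : ℕ → (ℕ → List A) → List A
    ⋃ n f = concatMap f (upTo n)

  syntax ⋃ n (λ i → xs) = ⋃[ i < n ] xs

  opaque
    unfolding ⋃

    ⋃-zero : ∀ (f : ℕ → List A) → ⋃ zero f ≡ []
    ⋃-zero f = refl

    ⋃-suc : ∀ n (f : ℕ → List A) → ⋃ (suc n) f ≡ ⋃ n f ++ f n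
    ⋃-suc n f = begin
      concatMap f (upTo (suc n))               ≡⟨ cong (concatMap f) (upTo-∷ʳ n) ⟨
      concatMap f (upTo n ++ [ n ])            ≡⟨ concatMap-++ f (upTo n) [ n ] ⟩
      concatMap f (upTo n) ++ (f n ++ [])      ≡⟨ cong (concatMap f (upTo n) ++_) (++-identityʳ (f n)) ⟩
      concatMap f (upTo n) ++ f n              ∎
      where open ≡-Reasoning

    ∈-⋃⁺ : ∀ {n i} {f : ℕ → List A} {x} → i < n → x ∈ f i → x ∈ ⋃ n f
    ∈-⋃⁺ {f = f} i<n x∈fi = ∈-concatMap⁺ f (lose (∈-upTo⁺ i<n) x∈fi)

    ∈-⋃⁻ : ∀ {n} {f : ℕ → List A} {x} → x ∈ ⋃ n f → ∃[ i ] i < n × x ∈ f i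
    ∈-⋃⁻ {f = f} x∈ with i , i∈ , x∈fi ← find (∈-concatMap⁻ f x∈) = i , ∈-upTo⁻ i∈ , x∈fi

  length-⋃ : ∀ n (f : ℕ → List A) → length (⋃ n f) ≡ ∑< n (λ i → length (f i))
  length-⋃ zero    f = cong length (⋃-zero f)
  length-⋃ (suc n) f = trans (cong length (⋃-suc n f)) (trans (length-++ (⋃ n f)) (cong (_+ length (f n)) (length-⋃ n f)))

  Unique-⋃ : ∀ {n} {f : ℕ → List A} (key : A → ℕ) → (∀ i → i < n → All (λ x → key x ≡ i) (f i)) →
             (∀ i → i < n → Unique (f i)) → Unique (⋃ n f)
  Unique-⋃ {zero}  {f} key tagged unique = subst Unique (sym (⋃-zero f)) []
  Unique-⋃ {suc n} {f} key tagged unique = subst Unique (sym (⋃-suc n f))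
    (++⁺ (Unique-⋃ key (λ i i<n → tagged i (m<n⇒m<1+n i<n)) (λ i i<n → unique i (m<n⇒m<1+n i<n)))
         (unique n ≤-refl) separated)
    where
    separated : ∀ {x} → ¬ (x ∈ ⋃ n f × x ∈ f n)
    separated (x∈⋃ , x∈fn) with i , i<n , x∈fi ← ∈-⋃⁻ x∈⋃ =
      <-irrefl (trans (sym (All.lookup (tagged i (m<n⇒m<1+n i<n)) x∈fi)) (All.lookup (tagged n ≤-refl) x∈fn)) i<n

  All-⋃ : ∀ {P : A → Set} {n} {f : ℕ → List A} → (∀ i → i < n → All P (f i)) → All P (⋃ n f)
  All-⋃ all = All.tabulate λ x∈ → let i , i<n , x∈fi = ∈-⋃⁻ x∈ in All.lookup (all i i<n) x∈fi

  length-⋃-cong : ∀ {n} {f : ℕ → List A} {g : ℕ → ℕ} → (∀ i → i < n → length (f i) ≡ g i) → length (⋃ n f) ≡ ∑< n g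
  length-⋃-cong {n} {f} lengths = trans (length-⋃ n f) (∑<-cong n lengths)

  length-⋃-const : ∀ {n} {f : ℕ → List A} {c} → (∀ i → i < n → length (f i) ≡ c) → length (⋃ n f) ≡ n * c
  length-⋃-const {n} {c = c} lengths = trans (length-⋃-cong lengths) (∑<-const n c)

  length-⋃-singletons : ∀ n (g : ℕ → A) → length (⋃[ i < n ] [ g i ]) ≡ n
  length-⋃-singletons n g = trans (length-⋃-const {c = 1} (λ _ _ → refl)) (*-identityʳ n)

∑<-shift : ∀ (f : ℕ → ℕ) n → ∑< (suc n) f ≡ f 0 + ∑< n (λ i → f (suc i))
∑<-shift f zero    = +-comm 0 (f 0)
∑<-shift f (suc n) = trans (cong (_+ f (suc n)) (∑<-shift f n)) (+-assoc (f 0) _ _)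

∑<-telescope : ∀ k (f F : ℕ → ℕ) → F 0 ≡ 0 → (∀ i → F i + k * f i ≡ F (suc i)) → ∀ n → k * ∑< n f ≡ F n
∑<-telescope k f F F0≡0 step zero    = trans (*-zeroʳ k) (sym F0≡0)
∑<-telescope k f F F0≡0 step (suc n) =
  trans (*-distribˡ-+ k (∑< n f) (f n)) (trans (cong (_+ k * f n) (∑<-telescope k f F F0≡0 step n)) (step n))

triangle : ℕ → ℕ
triangle a = ∑< a suc

2*triangle : ∀ a → 2 * triangle a ≡ a * suc a
2*triangle = ∑<-telescope 2 suc (λ a → a * suc a) refl step
  where
  step : ∀ i → i * suc i + 2 * suc i ≡ suc i * suc (suc i)
  step = solve-∀

2*∑id : ∀ n → 2 * ∑< (suc n) (λ a → a) ≡ n * suc n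
2*∑id n = ∑<-telescope 2 (λ a → a) F refl step (suc n)
  where
  F : ℕ → ℕ
  F zero    = 0
  F (suc n) = n * suc n
  step : ∀ i → F i + 2 * i ≡ F (suc i)
  step zero    = refl
  step (suc n) = solve n
    where
    solve : ∀ n → n * suc n + 2 * suc n ≡ suc n * suc (suc n)
    solve = solve-∀

4*∑cubes : ∀ n → 4 * ∑< (suc n) (λ a → a * (a * a)) ≡ n * n * suc n * suc n
4*∑cubes n = ∑<-telescope 4 (λ a → a * (a * a)) F refl step (suc n)
  where
  F : ℕ → ℕ
  F zero    = 0
  F (suc n) = n * n * suc n * suc n
  step : ∀ i → F i + 4 * (i * (i * i)) ≡ F (suc i)
  step zero    = refl
  step (suc n) = solve n
    where
    solve : ∀ n → n * n * suc n * suc n + 4 * (suc n * (suc n * suc n)) ≡ suc n * suc n * suc (suc n) * suc (suc n)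
    solve = solve-∀

6*triangle : ∀ a → 6 * triangle a ≡ 3 * (a * suc a)
6*triangle a = trans (*-assoc 3 2 (triangle a)) (cong (3 *_) (2*triangle a))

6*∑triangle∘suc : ∀ n → 6 * ∑< n (λ j → triangle (suc j)) ≡ n * suc n * suc (suc n)
6*∑triangle∘suc = ∑<-telescope 6 (λ j → triangle (suc j)) (λ n → n * suc n * suc (suc n)) refl step
  where
  step : ∀ i → i * suc i * suc (suc i) + 6 * triangle (suc i) ≡ suc i * suc (suc i) * suc (suc (suc i))
  step i = trans (cong (i * suc i * suc (suc i) +_) (6*triangle (suc i))) (solve i)
    where
    solve : ∀ n → n * suc n * suc (suc n) + 3 * (suc n * suc (suc n)) ≡ suc n * suc (suc n) * suc (suc (suc n))
    solve = solve-∀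

6*∑triangle : ∀ n → 6 * ∑< (suc n) triangle ≡ n * suc n * suc (suc n)
6*∑triangle n = trans (cong (6 *_) (∑<-shift triangle n)) (6*∑triangle∘suc n)

-- stated with both sides moved so that no subtraction occurs
12*∑large : ∀ q n → n ≤ q →
  12 * ∑< n (λ j → suc j * (suc j * (q ∸ j))) + 3 * (n * n * suc n * suc n) ≡ 2 * suc q * (n * suc n * (n + suc n))
12*∑large q zero    _   = sym (*-zeroʳ (2 * suc q))
12*∑large q (suc n) n<q =
  subst (λ x → 12 * (S + suc n * (suc n * (q ∸ n))) + 3 * A (suc n) ≡ 2 * suc x * P (suc n)) n+r≡q
    (step S n (q ∸ n) (subst (λ x → 12 * S + 3 * A n ≡ 2 * suc x * P n) (sym n+r≡q) (12*∑large q n (<⇒≤ n<q))))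
  where
  S : ℕ
  S = ∑< n (λ j → suc j * (suc j * (q ∸ j)))
  A P : ℕ → ℕ
  A n = n * n * suc n * suc n
  P n = n * suc n * (n + suc n)
  n+r≡q : n + (q ∸ n) ≡ q
  n+r≡q = m+[n∸m]≡n (<⇒≤ n<q)
  step : ∀ S n r → 12 * S + 3 * A n ≡ 2 * suc (n + r) * P n →
         12 * (S + suc n * (suc n * r)) + 3 * A (suc n) ≡ 2 * suc (n + r) * P (suc n)
  step S n r IH = +-cancelʳ-≡ (3 * A n) _ _ (begin
    12 * (S + suc n * (suc n * r)) + 3 * A (suc n) + 3 * A n    ≡⟨ regroup S (suc n * (suc n * r)) (3 * A n) (3 * A (suc n)) ⟩
    12 * S + 3 * A n + 12 * (suc n * (suc n * r)) + 3 * A (suc n) ≡⟨ cong (λ x → x + 12 * (suc n * (suc n * r)) + 3 * A (suc n)) IH ⟩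
    2 * suc (n + r) * P n + 12 * (suc n * (suc n * r)) + 3 * A (suc n) ≡⟨ polynomial n r ⟩
    2 * suc (n + r) * P (suc n) + 3 * A n                          ∎)
    where
    open ≡-Reasoning
    regroup : ∀ S t a a′ → 12 * (S + t) + a′ + a ≡ 12 * S + a + 12 * t + a′
    regroup = solve-∀
    polynomial : ∀ n r →
      2 * suc (n + r) * (n * suc n * (n + suc n)) + 12 * (suc n * (suc n * r)) + 3 * (suc n * suc n * suc (suc n) * suc (suc n)) ≡
      2 * suc (n + r) * (suc n * suc (suc n) * (suc n + suc (suc n))) + 3 * (n * n * suc n * suc n)
    polynomial = solve-∀

-- The canonical bounded matrices

swap₂₃ : ∀ {x y} a d → x ≤ y → (a , x , y , d) ≤ₗ (a , y , x , d)
swap₂₃ a d x≤y with m≤n⇒m<n∨m≡n x≤y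
... | inj₁ x<y = inj₂ (refl , inj₁ x<y)
... | inj₂ refl = ≤ₗ-refl

swap₂₄ : ∀ {x y} a c → x ≤ y → (a , x , c , y) ≤ₗ (a , y , c , x)
swap₂₄ a c x≤y with m≤n⇒m<n∨m≡n x≤y
... | inj₁ x<y = inj₂ (refl , inj₁ x<y)
... | inj₂ refl = ≤ₗ-refl

swap₃₄ : ∀ {x y} a b → x ≤ y → (a , b , x , y) ≤ₗ (a , b , y , x)
swap₃₄ a b x≤y with m≤n⇒m<n∨m≡n x≤y
... | inj₁ x<y = inj₂ (refl , inj₂ (refl , inj₁ x<y))
... | inj₂ refl = ≤ₗ-refl

-- h₀ = ⌊q/2⌋ and h₁ = ⌈q/2⌉, characterised by their defining inequalities.
module Enumeration (q h₀ h₁ : ℕ)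
  (half₀ : ∀ M → M + M ≤ q ⇔ M ≤ h₀) (half₁ : ∀ M → M + M ≤ suc q ⇔ M ≤ h₁) where

  open Equivalence

  -- In a canonical matrix (a b / c d) the entry a is maximal; a shape records which entries tie
  -- with it, and the "large" shapes, those with a > ⌈q/2⌉, are parametrised by j = q − a.
  data Shape : Tup → Set where
    distinct-small : ∀ {a b c d} → b < a → c < a → d < a → a ≤ h₁ → Shape (a , b , c , d)
    distinct-large : ∀ {a b c d j} → j < h₀ → a + j ≡ q → b ≤ j → c ≤ j → d < a → Shape (a , b , c , d)
    row-tie        : ∀ {a c d} → c < a → d ≤ c → a ≤ h₀ → Shape (a , a , c , d)
    column-tie     : ∀ {a b d} → b < a → d ≤ b → a ≤ h₀ → Shape (a , b , a , d)
    diagonal-small : ∀ {a b c} → b < a → c ≤ b → a ≤ h₁ → Shape (a , b , c , a)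
    diagonal-large : ∀ {a b c j} → j < h₀ → a + j ≡ q → b ≤ j → c ≤ b → Shape (a , b , c , a)
    triple-tie     : ∀ {a d} → d < a → a ≤ h₀ → Shape (a , a , a , d)
    constant       : ∀ {a} → a ≤ h₀ → Shape (a , a , a , a)

  large⇒1+j<a : ∀ {a j} → j < h₀ → a + j ≡ q → suc j < a
  large⇒1+j<a {a} {j} j<h₀ a+j≡q = +-cancelʳ-≤ j (suc (suc j)) a
    (subst₂ _≤_ (+-suc (suc j) j) (sym a+j≡q) (from (half₀ (suc j)) j<h₀))

  large⇒<a : ∀ {a j x} → j < h₀ → a + j ≡ q → x ≤ j → x < a
  large⇒<a j<h₀ a+j≡q x≤j = ≤-<-trans x≤j (<-trans (n<1+n _) (large⇒1+j<a j<h₀ a+j≡q))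

  large⇒a≰h₁ : ∀ {a j} → j < h₀ → a + j ≡ q → ¬ a ≤ h₁
  large⇒a≰h₁ {a} {j} j<h₀ a+j≡q a≤h₁ = <-irrefl refl (≤-trans q+2≤a+a (from (half₁ a) a≤h₁))
    where
    q+2≤a+a : suc (suc q) ≤ a + a
    q+2≤a+a = subst (_≤ a + a) (trans (+-suc a (suc j)) (cong suc (trans (+-suc a j) (cong suc a+j≡q))))
                    (+-monoʳ-≤ a (large⇒1+j<a j<h₀ a+j≡q))

  module _ {a : ℕ} where

    <a+a⇒≤q : ∀ {n} → n < a + a → a ≤ h₁ → n ≤ q
    <a+a⇒≤q n<a+a a≤h₁ = ≤-pred (<-≤-trans n<a+a (from (half₁ a) a≤h₁))

    below-small : ∀ {x y} → x ≤ a → y < a → a ≤ h₁ → x + y ≤ q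
    below-small x≤a y<a = <a+a⇒≤q (+-mono-≤-< x≤a y<a)

    below-small′ : ∀ {x y} → x < a → y ≤ a → a ≤ h₁ → x + y ≤ q
    below-small′ x<a y≤a = <a+a⇒≤q (+-mono-<-≤ x<a y≤a)

    below-half : ∀ {x y} → x ≤ a → y ≤ a → a ≤ h₀ → x + y ≤ q
    below-half x≤a y≤a a≤h₀ = ≤-trans (+-mono-≤ x≤a y≤a) (from (half₀ a) a≤h₀)

    module _ {j : ℕ} (a+j≡q : a + j ≡ q) where

      below-large : ∀ {x y} → x ≤ a → y ≤ j → x + y ≤ q
      below-large {x} {y} x≤a y≤j = subst (x + y ≤_) a+j≡q (+-mono-≤ x≤a y≤j)

      below-large′ : ∀ {x y} → x ≤ j → y ≤ a → x + y ≤ q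
      below-large′ {x} {y} x≤j y≤a = subst (x + y ≤_) (trans (+-comm j a) a+j≡q) (+-mono-≤ x≤j y≤a)

  Shape⇒Bounded : ∀ {t} → Shape t → Bounded q t
  Shape⇒Bounded (distinct-small b<a c<a d<a a≤h₁) =
    below-small ≤-refl b<a a≤h₁ , below-small (<⇒≤ c<a) d<a a≤h₁ , below-small ≤-refl c<a a≤h₁ , below-small (<⇒≤ b<a) d<a a≤h₁
  Shape⇒Bounded (distinct-large j<h₀ a+j≡q b≤j c≤j d<a) =
    below-large a+j≡q ≤-refl b≤j , below-large′ a+j≡q c≤j (<⇒≤ d<a) , below-large a+j≡q ≤-refl c≤j , below-large′ a+j≡q b≤j (<⇒≤ d<a)
  Shape⇒Bounded (row-tie c<a d≤c a≤h₀) =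
    below-half ≤-refl ≤-refl a≤h₀ , below-half (<⇒≤ c<a) (≤-trans d≤c (<⇒≤ c<a)) a≤h₀ ,
    below-half ≤-refl (<⇒≤ c<a) a≤h₀ , below-half ≤-refl (≤-trans d≤c (<⇒≤ c<a)) a≤h₀
  Shape⇒Bounded (column-tie b<a d≤b a≤h₀) =
    below-half ≤-refl (<⇒≤ b<a) a≤h₀ , below-half ≤-refl (≤-trans d≤b (<⇒≤ b<a)) a≤h₀ ,
    below-half ≤-refl ≤-refl a≤h₀ , below-half (<⇒≤ b<a) (≤-trans d≤b (<⇒≤ b<a)) a≤h₀
  Shape⇒Bounded (diagonal-small b<a c≤b a≤h₁) =
    below-small ≤-refl b<a a≤h₁ , below-small′ (≤-<-trans c≤b b<a) ≤-refl a≤h₁ ,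
    below-small ≤-refl (≤-<-trans c≤b b<a) a≤h₁ , below-small′ b<a ≤-refl a≤h₁
  Shape⇒Bounded (diagonal-large j<h₀ a+j≡q b≤j c≤b) =
    below-large a+j≡q ≤-refl b≤j , below-large′ a+j≡q (≤-trans c≤b b≤j) ≤-refl ,
    below-large a+j≡q ≤-refl (≤-trans c≤b b≤j) , below-large′ a+j≡q b≤j ≤-refl
  Shape⇒Bounded (triple-tie d<a a≤h₀) =
    below-half ≤-refl ≤-refl a≤h₀ , below-half ≤-refl (<⇒≤ d<a) a≤h₀ , below-half ≤-refl ≤-refl a≤h₀ , below-half ≤-refl (<⇒≤ d<a) a≤h₀
  Shape⇒Bounded (constant a≤h₀) =
    below-half ≤-refl ≤-refl a≤h₀ , below-half ≤-refl ≤-refl a≤h₀ , below-half ≤-refl ≤-refl a≤h₀ , below-half ≤-refl ≤-refl a≤h₀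

  Shape⇒Canonical : ∀ {t} → Shape t → Canonical t
  Shape⇒Canonical (distinct-small b<a c<a d<a _) = λ where
    (false , false) → ≤ₗ-refl
    (true  , false) → inj₁ c<a
    (false , true ) → inj₁ b<a
    (true  , true ) → inj₁ d<a
  Shape⇒Canonical (distinct-large j<h₀ a+j≡q b≤j c≤j d<a) = λ where
    (false , false) → ≤ₗ-refl
    (true  , false) → inj₁ (large⇒<a j<h₀ a+j≡q c≤j)
    (false , true ) → inj₁ (large⇒<a j<h₀ a+j≡q b≤j)
    (true  , true ) → inj₁ d<a
  Shape⇒Canonical {a , _ , c , d} (row-tie c<a d≤c _) = λ where
    (false , false) → ≤ₗ-refl
    (true  , false) → inj₁ c<a
    (false , true ) → swap₃₄ a a d≤c
    (true  , true ) → inj₁ (≤-<-trans d≤c c<a)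
  Shape⇒Canonical {a , b , _ , d} (column-tie b<a d≤b _) = λ where
    (false , false) → ≤ₗ-refl
    (true  , false) → swap₂₄ a a d≤b
    (false , true ) → inj₁ b<a
    (true  , true ) → inj₁ (≤-<-trans d≤b b<a)
  Shape⇒Canonical {a , b , c , _} (diagonal-small b<a c≤b _) = λ where
    (false , false) → ≤ₗ-refl
    (true  , false) → inj₁ (≤-<-trans c≤b b<a)
    (false , true ) → inj₁ b<a
    (true  , true ) → swap₂₃ a a c≤b
  Shape⇒Canonical {a , b , c , _} (diagonal-large j<h₀ a+j≡q b≤j c≤b) = λ where
    (false , false) → ≤ₗ-refl
    (true  , false) → inj₁ (large⇒<a j<h₀ a+j≡q (≤-trans c≤b b≤j))
    (false , true ) → inj₁ (large⇒<a j<h₀ a+j≡q b≤j)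
    (true  , true ) → swap₂₃ a a c≤b
  Shape⇒Canonical (triple-tie d<a _) = λ where
    (false , false) → ≤ₗ-refl
    (true  , false) → inj₂ (refl , inj₁ d<a)
    (false , true ) → inj₂ (refl , inj₂ (refl , inj₁ d<a))
    (true  , true ) → inj₁ d<a
  Shape⇒Canonical (constant _) = λ where
    (false , false) → ≤ₗ-refl
    (true  , false) → ≤ₗ-refl
    (false , true ) → ≤ₗ-refl
    (true  , true ) → ≤ₗ-refl

  a≰h₁⇒j<h₀ : ∀ {a j} → ¬ a ≤ h₁ → a + j ≡ q → j < h₀
  a≰h₁⇒j<h₀ {a} {j} a≰h₁ a+j≡q = to (half₀ (suc j)) (subst₂ _≤_ (sym (+-suc (suc j) j)) a+j≡q (+-monoˡ-≤ j j+2≤a))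
    where
    a+j+2≤a+a : a + suc (suc j) ≤ a + a
    a+j+2≤a+a = subst (_≤ a + a) (sym (trans (+-suc a (suc j)) (cong suc (trans (+-suc a j) (cong suc a+j≡q)))))
                      (≰⇒> (a≰h₁ ∘ to (half₁ a)))
    j+2≤a : suc (suc j) ≤ a
    j+2≤a = +-cancelˡ-≤ a _ _ a+j+2≤a+a

  Canonical⇒ties : ∀ {a b c d} → Canonical (a , b , c , d) →
    (b < a ⊎ b ≡ a × d ≤ c) × (c < a ⊎ c ≡ a × d ≤ b) × (d < a ⊎ d ≡ a × c ≤ b)
  Canonical⇒ties canonical = columns (canonical (false , true)) , rows (canonical (true , false)) , diagonal (canonical (true , true))
    where
    columns : ∀ {a b c d} → (b , a , d , c) ≤ₗ (a , b , c , d) → b < a ⊎ b ≡ a × d ≤ c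
    columns (inj₁ b<a)                                 = inj₁ b<a
    columns (inj₂ (refl , inj₁ a<a))                   = ⊥-elim (<-irrefl refl a<a)
    columns (inj₂ (refl , inj₂ (_ , inj₁ d<c)))        = inj₂ (refl , <⇒≤ d<c)
    columns (inj₂ (refl , inj₂ (_ , inj₂ (refl , _)))) = inj₂ (refl , ≤-refl)
    rows : ∀ {a b c d} → (c , d , a , b) ≤ₗ (a , b , c , d) → c < a ⊎ c ≡ a × d ≤ b
    rows (inj₁ c<a)                   = inj₁ c<a
    rows (inj₂ (refl , inj₁ d<b))     = inj₂ (refl , <⇒≤ d<b)
    rows (inj₂ (refl , inj₂ (refl , _))) = inj₂ (refl , ≤-refl)
    diagonal : ∀ {a b c d} → (d , c , b , a) ≤ₗ (a , b , c , d) → d < a ⊎ d ≡ a × c ≤ b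
    diagonal (inj₁ d<a)                   = inj₁ d<a
    diagonal (inj₂ (refl , inj₁ c<b))     = inj₂ (refl , <⇒≤ c<b)
    diagonal (inj₂ (refl , inj₂ (refl , _))) = inj₂ (refl , ≤-refl)

  complement : ∀ a {x} → a + x ≤ q → a + (q ∸ a) ≡ q
  complement a {x} a+x≤q = m+[n∸m]≡n (≤-trans (m≤m+n a x) a+x≤q)

  ≤∸ : ∀ a {x} → a + x ≤ q → x ≤ q ∸ a
  ≤∸ a {x} a+x≤q = m+n≤o⇒m≤o∸n x (subst (_≤ q) (+-comm a x) a+x≤q)

  shapeOf : ∀ {t} → Bounded q t → Canonical t → Shape t
  shapeOf {a , b , c , d} (a+b≤q , _ , a+c≤q , _) canonical with Canonical⇒ties canonical
  ... | inj₂ (refl , d≤c) , inj₁ c<a , _ = row-tie c<a d≤c (to (half₀ a) a+b≤q)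
  ... | inj₂ (refl , d≤c) , inj₂ (refl , _) , _ with m≤n⇒m<n∨m≡n d≤c
  ...   | inj₁ d<a  = triple-tie d<a (to (half₀ a) a+b≤q)
  ...   | inj₂ refl = constant (to (half₀ a) a+b≤q)
  shapeOf {a , b , c , d} (a+b≤q , _ , a+c≤q , _) canonical | inj₁ b<a , inj₂ (refl , d≤b) , _ =
    column-tie b<a d≤b (to (half₀ a) a+c≤q)
  shapeOf {a , b , c , d} (a+b≤q , _ , a+c≤q , _) canonical | inj₁ b<a , inj₁ c<a , d<a⊎d≡a with a ≤? h₁ | d<a⊎d≡a
  ... | yes a≤h₁ | inj₁ d<a          = distinct-small b<a c<a d<a a≤h₁
  ... | yes a≤h₁ | inj₂ (refl , c≤b) = diagonal-small b<a c≤b a≤h₁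
  ... | no a≰h₁  | inj₁ d<a          =
    distinct-large (a≰h₁⇒j<h₀ a≰h₁ (complement a a+b≤q)) (complement a a+b≤q) (≤∸ a a+b≤q) (≤∸ a a+c≤q) d<a
  ... | no a≰h₁  | inj₂ (refl , c≤b) =
    diagonal-large (a≰h₁⇒j<h₀ a≰h₁ (complement a a+b≤q)) (complement a a+b≤q) (≤∸ a a+b≤q) c≤b

  kind : ∀ {t} → Shape t → ℕ
  kind (distinct-small _ _ _ _)   = 0
  kind (distinct-large _ _ _ _ _) = 1
  kind (row-tie _ _ _)            = 2
  kind (column-tie _ _ _)         = 3
  kind (diagonal-small _ _ _)     = 4
  kind (diagonal-large _ _ _ _)   = 5
  kind (triple-tie _ _)           = 6
  kind (constant _)               = 7

  ofKind : ℕ → List Tup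
  ofKind 0 = ⋃[ a < suc h₁ ] ⋃[ b < a ] ⋃[ c < a ] ⋃[ d < a ] [ (a , b , c , d) ]
  ofKind 1 = ⋃[ j < h₀ ] ⋃[ b < suc j ] ⋃[ c < suc j ] ⋃[ d < q ∸ j ] [ (q ∸ j , b , c , d) ]
  ofKind 2 = ⋃[ a < suc h₀ ] ⋃[ c < a ] ⋃[ d < suc c ] [ (a , a , c , d) ]
  ofKind 3 = ⋃[ a < suc h₀ ] ⋃[ b < a ] ⋃[ d < suc b ] [ (a , b , a , d) ]
  ofKind 4 = ⋃[ a < suc h₁ ] ⋃[ b < a ] ⋃[ c < suc b ] [ (a , b , c , a) ]
  ofKind 5 = ⋃[ j < h₀ ] ⋃[ b < suc j ] ⋃[ c < suc b ] [ (q ∸ j , b , c , q ∸ j) ]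
  ofKind 6 = ⋃[ a < suc h₀ ] ⋃[ d < a ] [ (a , a , a , d) ]
  ofKind 7 = ⋃[ a < suc h₀ ] [ (a , a , a , a) ]
  ofKind _ = []

  h₀≤q : h₀ ≤ q
  h₀≤q = ≤-trans (m≤m+n h₀ h₀) (from (half₀ h₀) ≤-refl)

  ∸+ : ∀ {j} → j < h₀ → q ∸ j + j ≡ q
  ∸+ j<h₀ = m∸n+n≡m (≤-trans (<⇒≤ j<h₀) h₀≤q)

  ∸-large : ∀ {a j} → a + j ≡ q → q ∸ j ≡ a
  ∸-large {a} {j} a+j≡q = trans (cong (_∸ j) (sym a+j≡q)) (m+n∸n≡m a j)

  ∸∸ : ∀ {j} → j < h₀ → q ∸ (q ∸ j) ≡ j
  ∸∸ j<h₀ = m∸[m∸n]≡n (≤-trans (<⇒≤ j<h₀) h₀≤q)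

  ofKind⁻ : ∀ k {t} → t ∈ ofKind k → Σ[ s ∈ Shape t ] kind s ≡ k
  ofKind⁻ 0 t∈
    with a , a<  , t∈ ← ∈-⋃⁻ t∈ with b , b<a , t∈ ← ∈-⋃⁻ t∈
    with c , c<a , t∈ ← ∈-⋃⁻ t∈ with d , d<a , here refl ← ∈-⋃⁻ t∈
    = distinct-small b<a c<a d<a (≤-pred a<) , refl
  ofKind⁻ 1 t∈
    with j , j<h₀ , t∈ ← ∈-⋃⁻ t∈ with b , b< , t∈ ← ∈-⋃⁻ t∈
    with c , c< , t∈ ← ∈-⋃⁻ t∈ with d , d<a , here refl ← ∈-⋃⁻ t∈
    = distinct-large j<h₀ (∸+ j<h₀) (≤-pred b<) (≤-pred c<) d<a , refl
  ofKind⁻ 2 t∈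
    with a , a< , t∈ ← ∈-⋃⁻ t∈ with c , c<a , t∈ ← ∈-⋃⁻ t∈ with d , d< , here refl ← ∈-⋃⁻ t∈
    = row-tie c<a (≤-pred d<) (≤-pred a<) , refl
  ofKind⁻ 3 t∈
    with a , a< , t∈ ← ∈-⋃⁻ t∈ with b , b<a , t∈ ← ∈-⋃⁻ t∈ with d , d< , here refl ← ∈-⋃⁻ t∈
    = column-tie b<a (≤-pred d<) (≤-pred a<) , refl
  ofKind⁻ 4 t∈
    with a , a< , t∈ ← ∈-⋃⁻ t∈ with b , b<a , t∈ ← ∈-⋃⁻ t∈ with c , c< , here refl ← ∈-⋃⁻ t∈
    = diagonal-small b<a (≤-pred c<) (≤-pred a<) , refl
  ofKind⁻ 5 t∈
    with j , j<h₀ , t∈ ← ∈-⋃⁻ t∈ with b , b< , t∈ ← ∈-⋃⁻ t∈ with c , c< , here refl ← ∈-⋃⁻ t∈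
    = diagonal-large j<h₀ (∸+ j<h₀) (≤-pred b<) (≤-pred c<) , refl
  ofKind⁻ 6 t∈
    with a , a< , t∈ ← ∈-⋃⁻ t∈ with d , d<a , here refl ← ∈-⋃⁻ t∈
    = triple-tie d<a (≤-pred a<) , refl
  ofKind⁻ 7 t∈
    with a , a< , here refl ← ∈-⋃⁻ t∈
    = constant (≤-pred a<) , refl

  ofKind⁺ : ∀ {t} (s : Shape t) → t ∈ ofKind (kind s)
  ofKind⁺ (distinct-small b<a c<a d<a a≤h₁) = ∈-⋃⁺ (s≤s a≤h₁) (∈-⋃⁺ b<a (∈-⋃⁺ c<a (∈-⋃⁺ d<a (here refl))))
  ofKind⁺ {a , b , c , d} (distinct-large {j = j} j<h₀ a+j≡q b≤j c≤j d<a) =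
    subst (λ x → (x , b , c , d) ∈ ofKind 1) (∸-large a+j≡q)
      (∈-⋃⁺ j<h₀ (∈-⋃⁺ (s≤s b≤j) (∈-⋃⁺ (s≤s c≤j) (∈-⋃⁺ (subst (d <_) (sym (∸-large a+j≡q)) d<a) (here refl)))))
  ofKind⁺ (row-tie c<a d≤c a≤h₀)     = ∈-⋃⁺ (s≤s a≤h₀) (∈-⋃⁺ c<a (∈-⋃⁺ (s≤s d≤c) (here refl)))
  ofKind⁺ (column-tie b<a d≤b a≤h₀)  = ∈-⋃⁺ (s≤s a≤h₀) (∈-⋃⁺ b<a (∈-⋃⁺ (s≤s d≤b) (here refl)))
  ofKind⁺ (diagonal-small b<a c≤b a≤h₁) = ∈-⋃⁺ (s≤s a≤h₁) (∈-⋃⁺ b<a (∈-⋃⁺ (s≤s c≤b) (here refl)))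
  ofKind⁺ {a , b , c , _} (diagonal-large j<h₀ a+j≡q b≤j c≤b) =
    subst (λ x → (x , b , c , x) ∈ ofKind 5) (∸-large a+j≡q)
      (∈-⋃⁺ j<h₀ (∈-⋃⁺ (s≤s b≤j) (∈-⋃⁺ (s≤s c≤b) (here refl))))
  ofKind⁺ (triple-tie d<a a≤h₀) = ∈-⋃⁺ (s≤s a≤h₀) (∈-⋃⁺ d<a (here refl))
  ofKind⁺ (constant a≤h₀)       = ∈-⋃⁺ (s≤s a≤h₀) (here refl)

  topLeft topRight bottomLeft bottomRight : Tup → ℕ
  topLeft     (a , _ , _ , _) = a
  topRight    (_ , b , _ , _) = b
  bottomLeft  (_ , _ , c , _) = c
  bottomRight (_ , _ , _ , d) = d

  -- every level of a listing is tagged by the entry it enumerates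
  Unique-ofKind : ∀ k → Unique (ofKind k)
  Unique-ofKind 0 =
    Unique-⋃ topLeft (λ a _ → All-⋃ λ b _ → All-⋃ λ c _ → All-⋃ λ d _ → refl ∷ []) λ a _ →
    Unique-⋃ topRight (λ b _ → All-⋃ λ c _ → All-⋃ λ d _ → refl ∷ []) λ b _ →
    Unique-⋃ bottomLeft (λ c _ → All-⋃ λ d _ → refl ∷ []) λ c _ →
    Unique-⋃ bottomRight (λ d _ → refl ∷ []) λ d _ → [] ∷ []
  Unique-ofKind 1 =
    Unique-⋃ (λ t → q ∸ topLeft t) (λ j j<h₀ → All-⋃ λ b _ → All-⋃ λ c _ → All-⋃ λ d _ → ∸∸ j<h₀ ∷ []) λ j _ →
    Unique-⋃ topRight (λ b _ → All-⋃ λ c _ → All-⋃ λ d _ → refl ∷ []) λ b _ →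
    Unique-⋃ bottomLeft (λ c _ → All-⋃ λ d _ → refl ∷ []) λ c _ →
    Unique-⋃ bottomRight (λ d _ → refl ∷ []) λ d _ → [] ∷ []
  Unique-ofKind 2 =
    Unique-⋃ topLeft (λ a _ → All-⋃ λ c _ → All-⋃ λ d _ → refl ∷ []) λ a _ →
    Unique-⋃ bottomLeft (λ c _ → All-⋃ λ d _ → refl ∷ []) λ c _ →
    Unique-⋃ bottomRight (λ d _ → refl ∷ []) λ d _ → [] ∷ []
  Unique-ofKind 3 =
    Unique-⋃ topLeft (λ a _ → All-⋃ λ b _ → All-⋃ λ d _ → refl ∷ []) λ a _ →
    Unique-⋃ topRight (λ b _ → All-⋃ λ d _ → refl ∷ []) λ b _ →
    Unique-⋃ bottomRight (λ d _ → refl ∷ []) λ d _ → [] ∷ []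
  Unique-ofKind 4 =
    Unique-⋃ topLeft (λ a _ → All-⋃ λ b _ → All-⋃ λ c _ → refl ∷ []) λ a _ →
    Unique-⋃ topRight (λ b _ → All-⋃ λ c _ → refl ∷ []) λ b _ →
    Unique-⋃ bottomLeft (λ c _ → refl ∷ []) λ c _ → [] ∷ []
  Unique-ofKind 5 =
    Unique-⋃ (λ t → q ∸ topLeft t) (λ j j<h₀ → All-⋃ λ b _ → All-⋃ λ c _ → ∸∸ j<h₀ ∷ []) λ j _ →
    Unique-⋃ topRight (λ b _ → All-⋃ λ c _ → refl ∷ []) λ b _ →
    Unique-⋃ bottomLeft (λ c _ → refl ∷ []) λ c _ → [] ∷ []
  Unique-ofKind 6 =
    Unique-⋃ topLeft (λ a _ → All-⋃ λ d _ → refl ∷ []) λ a _ →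
    Unique-⋃ bottomRight (λ d _ → refl ∷ []) λ d _ → [] ∷ []
  Unique-ofKind 7 = Unique-⋃ topLeft (λ a _ → refl ∷ []) λ a _ → [] ∷ []
  Unique-ofKind (suc (suc (suc (suc (suc (suc (suc (suc _)))))))) = []

  ≢< : ∀ {a x} → x < a → a ≢ x
  ≢< x<a a≡x = <-irrefl (sym a≡x) x<a

  kindOf : Tup → ℕ
  kindOf (a , b , c , d) =
    if does (a ≟ b) then (if does (a ≟ c) then (if does (a ≟ d) then 7 else 6) else 2)
    else if does (a ≟ c) then 3
    else if does (a ≟ d) then (if does (a ≤? h₁) then 4 else 5)
    else (if does (a ≤? h₁) then 0 else 1)

  kindOf-kind : ∀ {t} (s : Shape t) → kindOf t ≡ kind s
  kindOf-kind {a , b , c , d} (distinct-small b<a c<a d<a a≤h₁)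
    rewrite dec-false (a ≟ b) (≢< b<a) | dec-false (a ≟ c) (≢< c<a) | dec-false (a ≟ d) (≢< d<a) | dec-true (a ≤? h₁) a≤h₁ = refl
  kindOf-kind {a , b , c , d} (distinct-large j<h₀ a+j≡q b≤j c≤j d<a)
    rewrite dec-false (a ≟ b) (≢< (large⇒<a j<h₀ a+j≡q b≤j)) | dec-false (a ≟ c) (≢< (large⇒<a j<h₀ a+j≡q c≤j)) | dec-false (a ≟ d) (≢< d<a)
          | dec-false (a ≤? h₁) (large⇒a≰h₁ j<h₀ a+j≡q) = refl
  kindOf-kind {a , _ , c , d} (row-tie c<a d≤c a≤h₀)
    rewrite dec-true (a ≟ a) refl | dec-false (a ≟ c) (≢< c<a) = refl
  kindOf-kind {a , b , _ , d} (column-tie b<a d≤b a≤h₀)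
    rewrite dec-false (a ≟ b) (≢< b<a) | dec-true (a ≟ a) refl = refl
  kindOf-kind {a , b , c , _} (diagonal-small b<a c≤b a≤h₁)
    rewrite dec-false (a ≟ b) (≢< b<a) | dec-false (a ≟ c) (≢< (≤-<-trans c≤b b<a)) | dec-true (a ≟ a) refl | dec-true (a ≤? h₁) a≤h₁ = refl
  kindOf-kind {a , b , c , _} (diagonal-large j<h₀ a+j≡q b≤j c≤b)
    rewrite dec-false (a ≟ b) (≢< (large⇒<a j<h₀ a+j≡q b≤j)) | dec-false (a ≟ c) (≢< (large⇒<a j<h₀ a+j≡q (≤-trans c≤b b≤j))) | dec-true (a ≟ a) refl
          | dec-false (a ≤? h₁) (large⇒a≰h₁ j<h₀ a+j≡q) = refl
  kindOf-kind {a , _ , _ , d} (triple-tie d<a a≤h₀)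
    rewrite dec-true (a ≟ a) refl | dec-false (a ≟ d) (≢< d<a) = refl
  kindOf-kind {a , _ , _ , _} (constant a≤h₀)
    rewrite dec-true (a ≟ a) refl = refl

  kind<8 : ∀ {t} (s : Shape t) → kind s < 8
  kind<8 (distinct-small _ _ _ _)   = s≤s z≤n
  kind<8 (distinct-large _ _ _ _ _) = s≤s (s≤s z≤n)
  kind<8 (row-tie _ _ _)            = s≤s (s≤s (s≤s z≤n))
  kind<8 (column-tie _ _ _)         = s≤s (s≤s (s≤s (s≤s z≤n)))
  kind<8 (diagonal-small _ _ _)     = s≤s (s≤s (s≤s (s≤s (s≤s z≤n))))
  kind<8 (diagonal-large _ _ _ _)   = s≤s (s≤s (s≤s (s≤s (s≤s (s≤s z≤n)))))
  kind<8 (triple-tie _ _)           = s≤s (s≤s (s≤s (s≤s (s≤s (s≤s (s≤s z≤n))))))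
  kind<8 (constant _)               = ≤-refl

  canonicalMatrices : List Tup
  canonicalMatrices = ⋃[ k < 8 ] ofKind k

  canonicalMatrices-unique : Unique canonicalMatrices
  canonicalMatrices-unique = Unique-⋃ kindOf
    (λ k _ → All.tabulate λ t∈ → let s , kind≡k = ofKind⁻ k t∈ in trans (kindOf-kind s) kind≡k)
    (λ k _ → Unique-ofKind k)

  canonicalMatrices-sound : ∀ {t} → t ∈ canonicalMatrices → Bounded q t × Canonical t
  canonicalMatrices-sound t∈ with k , _ , t∈ofKind ← ∈-⋃⁻ t∈ with s , _ ← ofKind⁻ k t∈ofKind =
    Shape⇒Bounded s , Shape⇒Canonical s

  canonicalMatrices-complete : ∀ {t} → Bounded q t → Canonical t → t ∈ canonicalMatrices
  canonicalMatrices-complete bounded canonical = let s = shapeOf bounded canonical in ∈-⋃⁺ (kind<8 s) (ofKind⁺ s)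

  sizeOfKind : ℕ → ℕ
  sizeOfKind 0 = ∑< (suc h₁) (λ a → a * (a * a))
  sizeOfKind 1 = ∑< h₀ (λ j → suc j * (suc j * (q ∸ j)))
  sizeOfKind 2 = ∑< (suc h₀) triangle
  sizeOfKind 3 = ∑< (suc h₀) triangle
  sizeOfKind 4 = ∑< (suc h₁) triangle
  sizeOfKind 5 = ∑< h₀ (λ j → triangle (suc j))
  sizeOfKind 6 = ∑< (suc h₀) (λ a → a)
  sizeOfKind 7 = suc h₀
  sizeOfKind _ = 0

  length-ofKind : ∀ k → length (ofKind k) ≡ sizeOfKind k
  length-ofKind 0 = length-⋃-cong λ a _ → length-⋃-const λ b _ → length-⋃-const λ c _ → length-⋃-singletons a _
  length-ofKind 1 = length-⋃-cong λ j _ → length-⋃-const λ b _ → length-⋃-const λ c _ → length-⋃-singletons (q ∸ j) _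
  length-ofKind 2 = length-⋃-cong λ a _ → length-⋃-cong λ c _ → length-⋃-singletons (suc c) _
  length-ofKind 3 = length-⋃-cong λ a _ → length-⋃-cong λ b _ → length-⋃-singletons (suc b) _
  length-ofKind 4 = length-⋃-cong λ a _ → length-⋃-cong λ b _ → length-⋃-singletons (suc b) _
  length-ofKind 5 = length-⋃-cong λ j _ → length-⋃-cong λ b _ → length-⋃-singletons (suc b) _
  length-ofKind 6 = length-⋃-cong λ a _ → length-⋃-singletons a _
  length-ofKind 7 = length-⋃-singletons (suc h₀) _
  length-ofKind (suc (suc (suc (suc (suc (suc (suc (suc _)))))))) = refl

  24*count : 24 * length canonicalMatrices + 2 * (3 * (h₀ * h₀ * suc h₀ * suc h₀)) ≡
    6 * (h₁ * h₁ * suc h₁ * suc h₁) + 2 * (2 * suc q * (h₀ * suc h₀ * (h₀ + suc h₀))) + 8 * (h₀ * suc h₀ * suc (suc h₀))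
    + 4 * (h₁ * suc h₁ * suc (suc h₁)) + 4 * (h₀ * suc h₀ * suc (suc h₀)) + 12 * (h₀ * suc h₀) + 24 * suc h₀
  24*count = begin
    24 * length canonicalMatrices + 2 * Y                      ≡⟨ cong (λ n → 24 * n + 2 * Y) (length-⋃-cong (λ k _ → length-ofKind k)) ⟩
    24 * (ℓ 0 + ℓ 1 + ℓ 2 + ℓ 3 + ℓ 4 + ℓ 5 + ℓ 6 + ℓ 7) + 2 * Y  ≡⟨ regroup (ℓ 0) (ℓ 1) (ℓ 2) (ℓ 4) (ℓ 5) (ℓ 6) (ℓ 7) Y ⟩
    6 * (4 * ℓ 0) + 2 * (12 * ℓ 1 + Y) + 8 * (6 * ℓ 2) + 4 * (6 * ℓ 4) + 4 * (6 * ℓ 5) + 12 * (2 * ℓ 6) + 24 * ℓ 7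
      ≡⟨ closed {g = suc h₀} (4*∑cubes h₁) (12*∑large q h₀ h₀≤q) (6*∑triangle h₀) (6*∑triangle h₁) (6*∑triangle∘suc h₀) (2*∑id h₀) ⟩
    6 * (h₁ * h₁ * suc h₁ * suc h₁) + 2 * (2 * suc q * (h₀ * suc h₀ * (h₀ + suc h₀))) + 8 * (h₀ * suc h₀ * suc (suc h₀))
      + 4 * (h₁ * suc h₁ * suc (suc h₁)) + 4 * (h₀ * suc h₀ * suc (suc h₀)) + 12 * (h₀ * suc h₀) + 24 * suc h₀ ∎
    where
    open ≡-Reasoning
    ℓ : ℕ → ℕ
    ℓ = sizeOfKind
    Y : ℕ
    Y = 3 * (h₀ * h₀ * suc h₀ * suc h₀)
    regroup : ∀ l₀ l₁ l₂ l₄ l₅ l₆ l₇ y → 24 * (l₀ + l₁ + l₂ + l₂ + l₄ + l₅ + l₆ + l₇) + 2 * y ≡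
              6 * (4 * l₀) + 2 * (12 * l₁ + y) + 8 * (6 * l₂) + 4 * (6 * l₄) + 4 * (6 * l₅) + 12 * (2 * l₆) + 24 * l₇
    regroup = solve-∀
    closed : ∀ {a a′ b b′ c c′ d d′ e e′ f f′ g} → a ≡ a′ → b ≡ b′ → c ≡ c′ → d ≡ d′ → e ≡ e′ → f ≡ f′ →
             6 * a + 2 * b + 8 * c + 4 * d + 4 * e + 12 * f + 24 * g ≡ 6 * a′ + 2 * b′ + 8 * c′ + 4 * d′ + 4 * e′ + 12 * f′ + 24 * g
    closed refl refl refl refl refl refl = refl

index-∈-lookup : ∀ {A : Set} (xs : List A) i → index (∈-lookup {xs = xs} i) ≡ i
index-∈-lookup (_ ∷ _)  zero    = refl
index-∈-lookup (_ ∷ xs) (suc i) = cong suc (index-∈-lookup xs i)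

module _ {p q : ℕ} (1≤q : 1 ≤ q) (4q≤p : 4 * q ≤ p) (L : List Tup) (unique : Unique L)
  (sound : ∀ {t} → t ∈ L → Bounded q t × Canonical t) (complete : ∀ {t} → Bounded q t → Canonical t → t ∈ L) where

  private
    ∈-irrelevant : ∀ {t} (m m′ : t ∈ L) → m ≡ m′
    ∈-irrelevant = unique⇒irrelevant (setoid Tup) (Decidable⇒UIP.≡-irrelevant (DecTotalOrder._≟_ ≤ₗ-decTotalOrder)) unique

    index-cong : ∀ {t t′} → t ≡ t′ → (m : t ∈ L) (m′ : t′ ∈ L) → index m ≡ index m′
    index-cong refl m m′ = cong index (∈-irrelevant m m′)

    canon∈L : ∀ (x : Family p q 2 × Family p q 2) → canon (meetsOf x) ∈ L
    canon∈L x = complete (Bounded-canon (meetsOf x) (meetsOf-bounded x)) (canon-canonical (meetsOf x))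

  classIndex : Family p q 2 × Family p q 2 → Fin (length L)
  classIndex x = index (canon∈L x)

  classIndex≡⇒∼ : ∀ x y → classIndex x ≡ classIndex y → x ∼ y
  classIndex≡⇒∼ x y same = canon≡⇒∼ {x = x} {y} (begin
    canon (meetsOf x)                  ≡⟨ lookup-index (canon∈L x) ⟩
    List.lookup L (classIndex x)            ≡⟨ cong (List.lookup L) same ⟩
    List.lookup L (classIndex y)            ≡⟨ lookup-index (canon∈L y) ⟨
    canon (meetsOf y)                  ∎)
    where open ≡-Reasoning

  numClasses : NumClasses p q 2 (length L)
  numClasses = classIndex , surjective , λ x y → mk⇔ (classIndex≡⇒∼ x y) (λ x∼y → index-cong (∼⇒canon≡ {x = x} {y} x∼y) (canon∈L x) (canon∈L y))
    where
    surjective : Surjective _≡_ _≡_ classIndex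
    surjective i = x , λ { refl → trans (index-cong canon≡ (canon∈L x) (∈-lookup i)) (index-∈-lookup L i) }
      where
      boundedCanonical : Bounded q (List.lookup L i) × Canonical (List.lookup L i)
      boundedCanonical = sound (∈-lookup i)
      realized : ∃[ x ] meetsOf x ≡ List.lookup L i
      realized = realize 1≤q 4q≤p (List.lookup L i) (proj₁ boundedCanonical)
      x : Family p q 2 × Family p q 2
      x = proj₁ realized
      canon≡ : canon (meetsOf x) ≡ List.lookup L i
      canon≡ = trans (cong canon (proj₂ realized)) (canonical⇒canon≡ (proj₂ boundedCanonical))

double≤1+double⇒≤ : ∀ {M m} → M + M ≤ suc (m + m) → M ≤ m
double≤1+double⇒≤ {M} {m} M+M≤ with m <? M
... | no  m≮M = ≮⇒≥ m≮M
... | yes m<M = ⊥-elim (1+n≰n (≤-trans (subst (_≤ M + M) (cong suc (+-suc m m)) (+-mono-≤ m<M m<M)) M+M≤))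

half-even : ∀ m M → M + M ≤ m + m ⇔ M ≤ m
half-even m M = mk⇔ (double≤1+double⇒≤ ∘ m≤n⇒m≤1+n) (λ M≤m → +-mono-≤ M≤m M≤m)

half-odd : ∀ m M → M + M ≤ suc (m + m) ⇔ M ≤ m
half-odd m M = mk⇔ double≤1+double⇒≤ (λ M≤m → m≤n⇒m≤1+n (+-mono-≤ M≤m M≤m))

half-even+2 : ∀ m M → M + M ≤ suc (suc (m + m)) ⇔ M ≤ suc m
half-even+2 m M = subst (λ n → M + M ≤ n ⇔ M ≤ suc m) (cong suc (+-suc m m)) (half-even (suc m) M)

data Parity : ℕ → Set where
  even : ∀ m → Parity (m + m)
  odd  : ∀ m → Parity (suc (m + m))

parity : ∀ n → Parity n
parity zero = even 0
parity (suc n) with parity n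
... | even m = odd m
... | odd m  = subst Parity (cong suc (+-suc m m)) (even (suc m))

double%2 : ∀ m → (m + m) % 2 ≡ 0
double%2 m = trans (cong (_% 2) (double≡*2 m)) (m*n%n≡0 m 2)
  where
  double≡*2 : ∀ m → m + m ≡ m * 2
  double≡*2 = solve-∀

1+double%2 : ∀ m → suc (m + m) % 2 ≡ 1
1+double%2 m = trans (cong (_% 2) (1+double≡ m)) ([m+kn]%n≡m%n 1 m 2)
  where
  1+double≡ : ∀ m → suc (m + m) ≡ 1 + m * 2
  1+double≡ = solve-∀

module EvenCount (m : ℕ) where
  open Enumeration (m + m) m m (half-even m) (half-odd m) public

  24*count-even : let q = m + m in 24 * length canonicalMatrices ≡ q ^ 4 + 6 * q ^ 3 + 20 * q ^ 2 + 36 * q + 24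
  24*count-even = +-cancelʳ-≡ _ _ _ (trans 24*count (polynomial m))
    where
    polynomial : ∀ m →
      6 * (m * m * suc m * suc m) + 2 * (2 * suc (m + m) * (m * suc m * (m + suc m))) + 8 * (m * suc m * suc (suc m))
      + 4 * (m * suc m * suc (suc m)) + 4 * (m * suc m * suc (suc m)) + 12 * (m * suc m) + 24 * suc m ≡
      (m + m) * ((m + m) * ((m + m) * ((m + m) * 1))) + 6 * ((m + m) * ((m + m) * ((m + m) * 1)))
      + 20 * ((m + m) * ((m + m) * 1)) + 36 * (m + m) + 24 + 2 * (3 * (m * m * suc m * suc m))
    polynomial = solve-∀

module OddCount (m : ℕ) where
  open Enumeration (suc (m + m)) m (suc m) (half-odd m) (half-even+2 m) public

  24*count-odd : let q = suc (m + m) in 24 * length canonicalMatrices ≡ q ^ 4 + 6 * q ^ 3 + 20 * q ^ 2 + 30 * q + 15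
  24*count-odd = +-cancelʳ-≡ _ _ _ (trans 24*count (polynomial m))
    where
    polynomial : ∀ m →
      6 * (suc m * suc m * suc (suc m) * suc (suc m)) + 2 * (2 * suc (suc (m + m)) * (m * suc m * (m + suc m))) + 8 * (m * suc m * suc (suc m))
      + 4 * (suc m * suc (suc m) * suc (suc (suc m))) + 4 * (m * suc m * suc (suc m)) + 12 * (m * suc m) + 24 * suc m ≡
      suc (m + m) * (suc (m + m) * (suc (m + m) * (suc (m + m) * 1))) + 6 * (suc (m + m) * (suc (m + m) * (suc (m + m) * 1)))
      + 20 * (suc (m + m) * (suc (m + m) * 1)) + 30 * suc (m + m) + 15 + 2 * (3 * (m * m * suc m * suc m))
    polynomial = solve-∀

proposition5p2 : (p q : ℕ) → 1 ≤ q → 4 * q ≤ p →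
    Σ ℕ (λ N → NumClasses p q 2 N
    × (q % 2 ≡ 0 → 24 * N ≡ q ^ 4 + 6 * q ^ 3 + 20 * q ^ 2 + 36 * q + 24)
    × (q % 2 ≡ 1 → 24 * N ≡ q ^ 4 + 6 * q ^ 3 + 20 * q ^ 2 + 30 * q + 15))
proposition5p2 p q 1≤q 4q≤p with parity q
... | even m = length canonicalMatrices
             , numClasses 1≤q 4q≤p canonicalMatrices canonicalMatrices-unique canonicalMatrices-sound canonicalMatrices-complete
             , (λ _ → 24*count-even) , (λ q%2≡1 → ⊥-elim (0≢1+n (trans (sym (double%2 m)) q%2≡1)))
  where open EvenCount m
... | odd m  = length canonicalMatrices
             , numClasses 1≤q 4q≤p canonicalMatrices canonicalMatrices-unique canonicalMatrices-sound canonicalMatrices-complete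
             , (λ q%2≡0 → ⊥-elim (0≢1+n (trans (sym q%2≡0) (1+double%2 m)))) , (λ _ → 24*count-odd)
  where open OddCount m
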